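{- Let $i,j,k\ge 0$ be integers. Let $G_1$ be a finite graph with distinguished vertices $v_1,\ldots,v_{i+j}$ and $G_2$ a finite graph with distinguished vertices $w_1,\ldots,w_{j+k}$. Let $G$ be the graph obtained from the disjoint union $G_1\sqcup G_2$ by identifying $v_{i+l}$ with $w_l$ for $l=1,\ldots,j$ (edge set $E(G_1)\sqcup E(G_2)$), with the $i+j+k$ distinguished vertices $v_1,\ldots,v_i,\ v_{i+1}=w_1,\ldots,v_{i+j}=w_j,\ w_{j+1},\ldots,w_{j+k}$ in this order. Let $I=\{i+1,\ldots,i+j\}\subset[i+j]$ and $J=\{1,\ldots,j\}\subset[j+k]$. Then \[ v_G=\phi_{I,J}(v_{G_1}\otimes v_{G_2}). \]
   Context: Let $\mathcal M$ be the unital ring $\mathbb Z\langle y,n\rangle/(yn=ny=n,\ n^2=0,\ y^2=y)$ (the matching algebra); tensor products are over $\mathbb Z$. Graphs are finite and may have multiple edges; a perfect matching is a set of edges covering every vertex exactly once. For a graph $G$ with distinguished vertices $v_1,\ldots,v_r$ and $(\epsilon_1,\ldots,\epsilon_r)\in\{y,n\}^r$, $G(\epsilon_1,\ldots,\epsilon_r)$ is the number of perfect matchings of the graph obtained from $G$ by deleting each $v_i$ with $\epsilon_i=y$ and keeping each $v_i$ with $\epsilon_i=n$. The state sum of $G$ is $v_G=\sum_{\epsilon\in\{y,n\}^r} G(\epsilon_1,\ldots,\epsilon_r)\,\epsilon_1\otimes\cdots\otimes\epsilon_r\in\mathcal M^{\otimes r}$. For $I=\{i_1<\cdots<i_s\}\subset[a]$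 and $J=\{j_1<\cdots<j_s\}\subset[b]$ (where $[a]=\{1,\ldots,a\}$), the internal multiplication $\phi_{I,J}:\mathcal M^{\otimes a}\otimes\mathcal M^{\otimes b}\to\mathcal M^{\otimes(a+b-s)}$ is the $\mathbb Z$-linear map with $\phi_{I,J}\big((A\,\epsilon_1\otimes\cdots\otimes\epsilon_a)\otimes(B\,\eta_1\otimes\cdots\otimes\eta_b)\big)=AB\,\epsilon'_1\otimes\cdots\otimes\epsilon'_a\otimes\eta_1\otimes\cdots\widehat{\eta_{j_1}}\cdots\widehat{\eta_{j_s}}\cdots\otimes\eta_b$, where $\epsilon'_{i_t}=\epsilon_{i_t}\eta_{j_t}$ (product in $\mathcal M$) for $t=1,\ldots,s$, $\epsilon'_p=\epsilon_p$ for $p\notin I$, and hats denote omitted factors; here $A,B\in\mathbb Z$ and $\epsilon_p,\eta_q\in\{y,n\}$. -}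

module Defs where

open import Data.Nat using (ℕ; zero; suc; _+_; _≡ᵇ_)
open import Data.Bool using (Bool; true; false; if_then_else_; _∧_; not)
open import Data.Unit using (⊤; tt)
open import Data.Fin using (Fin; zero; suc; _↑ˡ_; _↑ʳ_; splitAt; _≟_)
open import Data.List using (List; []; _∷_; _++_; map; length; foldr; concatMap; mapMaybe)
open import Data.Bool.ListAction using (any; all)
open import Data.Vec using (Vec; []; _∷_; lookup; toList; _[_]≔_)
open import Data.Maybe using (Maybe; just; nothing; _>>=_)
import Data.Maybe as Maybe
import Data.Maybe.Properties as MaybeP
import Data.List.Properties as ListP
open import Data.Product using (Σ; _,_; _×_; proj₁; proj₂)
import Data.Product as Prod
open import Data.Sum using (_⊎_; inj₁; inj₂; [_,_])
import Data.Sum as Sum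
open import Data.Integer using (ℤ; +_; _*_)
import Data.Integer as ℤ
open import Function using (_∘_)
open import Relation.Nullary using (does; yes; no; Dec)
open import Relation.Binary.PropositionalEquality using (_≡_; refl)

-- The symbols y, n of the matching algebra M and their products in M.
-- Pure tensors ε₁ ⊗ ⋯ ⊗ εᵣ with εᵢ ∈ {y,n} are words Vec YN r.

data YN : Set where
  Y N : YN

_≟YN_ : (a b : YN) → Dec (a ≡ b)
Y ≟YN Y = yes refl
Y ≟YN N = no (λ ())
N ≟YN Y = no (λ ())
N ≟YN N = yes refl

-- product in M : y·y = y, y·n = n·y = n, n·n = 0 (nothing = the zero element)
mulYN : YN → YN → Maybe YN
mulYN Y Y = just Y
mulYN Y N = just N
mulYN N Y = just N
mulYN N N = nothing

isY : YN → Bool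
isY Y = true
isY N = false

allFinL : (m : ℕ) → List (Fin m)
allFinL zero = []
allFinL (suc m) = zero ∷ map suc (allFinL m)

allWords : (r : ℕ) → List (Vec YN r)
allWords zero = [] ∷ []
allWords (suc r) = concatMap (λ w → (Y ∷ w) ∷ (N ∷ w) ∷ []) (allWords r)

-- An element of the Z-span of the pure y/n-tensors in M^{⊗r}
-- (a free Z-module on the 2^r words), given by its coefficients.
Tensor : ℕ → Set
Tensor r = Vec YN r → ℤ

sumℤ : List ℤ → ℤ
sumℤ = foldr ℤ._+_ (+ 0)

-- I = (i₁,…,iₛ), J = (j₁,…,jₛ) are given
-- as vectors of (0-based) positions, paired in order.  On pure tensors
-- ε ⊗ η the result is the word ε' ++ (η with positions in J omitted),
-- or zero (nothing) if some product ε_{i_t} η_{j_t} vanishes in M.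

combine : ∀ {a b s} → Vec (Fin a) s → Vec (Fin b) s →
          Vec YN a → Vec YN b → Maybe (List YN)
combine {a} {b} I J ε η = Maybe.map (λ e → toList e ++ rest) ε'
  where
  pairs : ∀ {s} → Vec (Fin a) s → Vec (Fin b) s → List (Fin a × Fin b)
  pairs [] [] = []
  pairs (p ∷ ps) (q ∷ qs) = (p , q) ∷ pairs ps qs

  step : Fin a × Fin b → Maybe (Vec YN a) → Maybe (Vec YN a)
  step (p , q) acc = acc >>= λ e → mulYN (lookup e p) (lookup η q) >>= λ c → just (e [ p ]≔ c)

  ε' : Maybe (Vec YN a)
  ε' = foldr step (just ε) (pairs I J)

  inJ : Fin b → Bool
  inJ q = any (λ q' → does (q' ≟ q)) (toList J)

  rest : List YN
  rest = concatMap (λ q → if inJ q then [] else lookup η q ∷ []) (allFinL b)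

-- coefficient of the word ω in φ_{I,J}(f ⊗ g)   (Z-bilinear extension)
φ : ∀ {a b s} → Vec (Fin a) s → Vec (Fin b) s → Tensor a → Tensor b → List YN → ℤ
φ {a} {b} I J f g ω =
  sumℤ (concatMap (λ ε → map (λ η →
      if does (MaybeP.≡-dec (ListP.≡-dec _≟YN_) (combine I J ε η) (just ω))
      then f ε * g η else + 0) (allWords b)) (allWords a))

-- Finite multigraphs: vertices Fin V, edges a list of (unordered) pairs of
-- endpoints; repeated entries are parallel edges.

record Graph : Set where
  constructor graph
  field
    V : ℕ
    E : List (Fin V × Fin V)
open Graph public

compress : {A : Set} (n : ℕ) → (Fin n → Maybe A) → Σ ℕ (λ m → Fin n → A ⊎ Fin m)
compress zero f = 0 , λ ()
compress (suc n) f with compress n (f ∘ suc) | f zero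
... | m , h | just a = m , λ { zero → inj₁ a ; (suc x) → h x }
... | m , h | nothing = suc m , λ { zero → inj₂ zero ; (suc x) → Sum.map₂ suc (h x) }

deleteV : (G : Graph) → (Fin (V G) → Bool) → Graph
deleteV G del = graph m (mapMaybe keepEdge (E G))
  where
  c = compress (V G) (λ x → if del x then just tt else nothing)
  m = proj₁ c
  h = proj₂ c
  both : ⊤ ⊎ Fin m → ⊤ ⊎ Fin m → Maybe (Fin m × Fin m)
  both (inj₂ a) (inj₂ b) = just (a , b)
  both _ _ = nothing
  keepEdge : Fin (V G) × Fin (V G) → Maybe (Fin m × Fin m)
  keepEdge (a , b) = both (h a) (h b)

subsets : {A : Set} → List A → List (List A)
subsets [] = [] ∷ []
subsets (e ∷ es) = map (e ∷_) (subsets es) ++ subsets es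


-- number of edge-endpoints of S at v (a loop counts twice)
deg : {V : ℕ} → List (Fin V × Fin V) → Fin V → ℕ
deg S v = foldr _+_ 0 (map (λ e → hit (proj₁ e) + hit (proj₂ e)) S)
  where
  hit : _ → ℕ
  hit a = if does (a ≟ v) then 1 else 0

isPerfectMatching : (G : Graph) → List (Fin (V G) × Fin (V G)) → Bool
isPerfectMatching G S = all (λ v → deg S v ≡ᵇ 1) (allFinL (V G))

pmCount : Graph → ℕ
pmCount G = length (Data.List.filterᵇ (isPerfectMatching G) (subsets (E G)))
  where import Data.List

record Pointed (r : ℕ) : Set where
  constructor pointed
  field
    gr : Graph
    pts : Fin r → Fin (V gr)
open Pointed public

stateSum : ∀ {r} → Pointed r → Tensor r
stateSum {r} P ε = + pmCount (deleteV (gr P) del)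
  where
  del : Fin (V (gr P)) → Bool
  del x = any (λ p → does (pts P p ≟ x) ∧ isY (lookup ε p)) (allFinL r)

glueLookup : {n : ℕ} {A : Set} (j : ℕ) → (Fin j → Fin n) → (Fin j → A) → Fin n → Maybe A
glueLookup zero ww vv x = nothing
glueLookup (suc j) ww vv x =
  if does (ww zero ≟ x) then just (vv zero) else glueLookup j (ww ∘ suc) (vv ∘ suc) x

glue : (i j k : ℕ) → Pointed (i + j) → Pointed (j + k) → Pointed (i + j + k)
glue i j k (pointed (graph V1 E1) v) (pointed (graph V2 E2) w) =
  pointed (graph (V1 + m) (map (Prod.map (_↑ˡ m) (_↑ˡ m)) E1 ++ map (Prod.map emb2 emb2) E2)) pts'
  where
  c = compress V2 (glueLookup j (λ l → w (l ↑ˡ k)) (λ l → v (i ↑ʳ l)))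
  m = proj₁ c
  emb2 : Fin V2 → Fin (V1 + m)
  emb2 x = [ (_↑ˡ m) , (V1 ↑ʳ_) ] (proj₂ c x)
  pts' : Fin (i + j + k) → Fin (V1 + m)
  pts' p = [ (λ a → v a ↑ˡ m) , (λ q → emb2 (w (j ↑ʳ q))) ] (splitAt (i + j) p)

{-# OPTIONS --safe #-}

-- The coefficient of ω in v_G counts the edge sets S of G that miss the distinguished vertices
-- labelled y and cover every other vertex exactly once. Such an S is the union of its parts
-- S₁ ⊆ E(G₁) and S₂ ⊆ E(G₂), and each part covers its distinguished vertices at most once and all
-- other vertices exactly once, so it determines the word recording which distinguished vertices it
-- misses. At a glued vertex the degrees of S₁ and S₂ add: a total of 0 or 1 arises exactly as
-- y·y = y and y·n = n·y = n do in M, while n·n = 0 discards a vertex covered by both parts. Hence S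
-- is counted for ω exactly when φ_{I,J} sends the tensor of the words of S₁ and S₂ to ω, and
-- grouping the pairs (S₁, S₂) by their words turns the count into the right-hand side.

module Submission where

open import Defs
open import Data.Nat using (ℕ; zero; suc; _+_; _*_; _≡ᵇ_; _≤_; z≤n; s≤s)
import Data.Nat.Properties as ℕ
open import Data.Bool using (Bool; true; false; T; if_then_else_; _∧_)
open import Data.Bool.Properties using (T-∧; T-≡)
open import Data.Bool.ListAction using (any; all)
open import Data.Fin using (Fin; zero; suc; _↑ˡ_; _↑ʳ_; splitAt; _≟_)
import Data.Fin.Properties as Fin
open import Data.List using (List; []; _∷_; _++_; map; foldr; length; concatMap; filterᵇ; mapMaybe; catMaybes)
import Data.List.Properties as List
open import Data.List.Membership.Propositional using (_∈_; lose)
open import Data.List.Membership.Propositional.Properties using (∈-map⁺)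
open import Data.List.Relation.Unary.Any using (here; there; satisfied)
import Data.List.Relation.Unary.All as All
open import Data.List.Relation.Unary.All.Properties using (all⁺; all⁻)
open import Data.List.Relation.Unary.Any.Properties using (any⁺; any⁻)
open import Data.Maybe using (Maybe; just; nothing; is-just; _>>=_)
import Data.Maybe as Maybe
import Data.Maybe.Properties as MaybeP
open import Data.Sum using (_⊎_; inj₁; inj₂; [_,_])
import Data.Sum as Sum
open import Data.Sum.Properties using ([,]-map; inj₂-injective)
open import Data.Product using (∃-syntax; _,_; _×_; proj₁; proj₂)
import Data.Product as Prod
open import Data.Vec using (Vec; []; _∷_; lookup; tabulate; toList; _[_]≔_)
import Data.Vec as Vec
import Data.Vec.Properties as Vec
open import Data.Empty using (⊥-elim)
open import Data.Unit using (⊤; tt)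
open import Data.Integer using (ℤ)
import Data.Integer as ℤ
import Data.Integer.Properties as ℤ
open import Function using (_∘_; const; case_of_; _⇔_; mk⇔; Equivalence)
open import Function.Definitions using (Injective)
open import Function.Properties.Equivalence using (⇔-setoid)
import Relation.Binary.Reasoning.Setoid as SetoidReasoning
open import Level using (0ℓ)
open import Relation.Nullary using (¬_; Dec; does; yes; no)
open import Relation.Nullary.Decidable using (dec-true; dec-false)
open import Relation.Binary.PropositionalEquality hiding ([_])
open import Algebra.Properties.CommutativeSemigroup ℕ.+-commutativeSemigroup using (interchange)

private
  variable
    A B : Set

T-injective : ∀ {a b} → (T a → T b) → (T b → T a) → a ≡ b
T-injective {true}  {true}  _ _ = refl
T-injective {true}  {false} f _ = ⊥-elim (f _)
T-injective {false} {true}  _ g = ⊥-elim (g _)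
T-injective {false} {false} _ _ = refl

T-does⁻ : ∀ {P : Set} (d : Dec P) → T (does d) → P
T-does⁻ (yes p) _ = p

T-does⁺ : ∀ {P : Set} (d : Dec P) → P → T (does d)
T-does⁺ d p = Equivalence.from T-≡ (dec-true d p)

¬T⇒≡false : ∀ {a} → ¬ T a → a ≡ false
¬T⇒≡false {true}  ¬a = ⊥-elim (¬a _)
¬T⇒≡false {false} _  = refl

-- Finite sums

∑ : List A → (A → ℕ) → ℕ
∑ []       f = 0
∑ (x ∷ xs) f = f x + ∑ xs f

infix 5 ∑
syntax ∑ xs (λ x → e) = ∑[ x ∈ xs ] e

∑-cong : ∀ (xs : List A) {f g : A → ℕ} → (∀ x → f x ≡ g x) → ∑ xs f ≡ ∑ xs g
∑-cong []       f≗g = refl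
∑-cong (x ∷ xs) f≗g = cong₂ _+_ (f≗g x) (∑-cong xs f≗g)

∑-zero : ∀ (xs : List A) {f : A → ℕ} → (∀ x → f x ≡ 0) → ∑ xs f ≡ 0
∑-zero xs f≗0 = trans (∑-cong xs f≗0) (∑-const xs)
  where
  ∑-const : ∀ (xs : List A) → ∑ xs (λ _ → 0) ≡ 0
  ∑-const []       = refl
  ∑-const (_ ∷ xs) = ∑-const xs

∑-++ : ∀ (xs ys : List A) (f : A → ℕ) → ∑ (xs ++ ys) f ≡ ∑ xs f + ∑ ys f
∑-++ []       ys f = refl
∑-++ (x ∷ xs) ys f = trans (cong (_+_ (f x)) (∑-++ xs ys f)) (sym (ℕ.+-assoc (f x) _ _))

∑-map : ∀ (g : A → B) xs (f : B → ℕ) → ∑ (map g xs) f ≡ ∑ xs (f ∘ g)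
∑-map g []       f = refl
∑-map g (x ∷ xs) f = cong (_+_ (f (g x))) (∑-map g xs f)

∑-concatMap : ∀ (g : A → List B) xs (f : B → ℕ) → ∑ (concatMap g xs) f ≡ ∑[ x ∈ xs ] ∑ (g x) f
∑-concatMap g []       f = refl
∑-concatMap g (x ∷ xs) f = trans (∑-++ (g x) _ f) (cong (_+_ (∑ (g x) f)) (∑-concatMap g xs f))

∑-+ : ∀ (xs : List A) (f g : A → ℕ) → ∑[ x ∈ xs ] (f x + g x) ≡ ∑ xs f + ∑ xs g
∑-+ []       f g = refl
∑-+ (x ∷ xs) f g = trans (cong (_+_ (f x + g x)) (∑-+ xs f g)) (interchange (f x) (g x) _ _)

∑-comm : ∀ (xs : List A) (ys : List B) (f : A → B → ℕ) →
  ∑[ x ∈ xs ] ∑[ y ∈ ys ] f x y ≡ ∑[ y ∈ ys ] ∑[ x ∈ xs ] f x y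
∑-comm []       ys f = sym (∑-zero ys (λ _ → refl))
∑-comm (x ∷ xs) ys f = trans (cong (_+_ (∑ ys (f x))) (∑-comm xs ys f)) (sym (∑-+ ys (f x) _))

∑-*ˡ : ∀ c (xs : List A) (f : A → ℕ) → c * ∑ xs f ≡ ∑[ x ∈ xs ] c * f x
∑-*ˡ c []       f = ℕ.*-zeroʳ c
∑-*ˡ c (x ∷ xs) f = trans (ℕ.*-distribˡ-+ c (f x) _) (cong (_+_ (c * f x)) (∑-*ˡ c xs f))

∑-*ʳ : ∀ c (xs : List A) (f : A → ℕ) → ∑ xs f * c ≡ ∑[ x ∈ xs ] f x * c
∑-*ʳ c []       f = refl
∑-*ʳ c (x ∷ xs) f = trans (ℕ.*-distribʳ-+ c (f x) _) (cong (_+_ (f x * c)) (∑-*ʳ c xs f))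

𝟙 : Bool → ℕ
𝟙 true  = 1
𝟙 false = 0

𝟙-∧ : ∀ a b → 𝟙 a * 𝟙 b ≡ 𝟙 (a ∧ b)
𝟙-∧ true  true  = refl
𝟙-∧ true  false = refl
𝟙-∧ false b     = refl

if-𝟙 : ∀ b c → (if b then 𝟙 c else 0) ≡ 𝟙 (b ∧ c)
if-𝟙 true  c = refl
if-𝟙 false c = refl

if-pos-* : ∀ b x y → (if b then ℤ.+ x ℤ.* ℤ.+ y else ℤ.+ 0) ≡ ℤ.+ (x * (y * 𝟙 b))
if-pos-* true  x y = trans (sym (ℤ.pos-* x y)) (cong (λ z → ℤ.+ (x * z)) (sym (ℕ.*-identityʳ y)))
if-pos-* false x y = cong ℤ.+_ (sym (trans (cong (x *_) (ℕ.*-zeroʳ y)) (ℕ.*-zeroʳ x)))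

sumℤ-++ : ∀ (ms ns : List ℤ) → sumℤ (ms ++ ns) ≡ sumℤ ms ℤ.+ sumℤ ns
sumℤ-++ []       ns = sym (ℤ.+-identityˡ _)
sumℤ-++ (m ∷ ms) ns = trans (cong (ℤ._+_ m) (sumℤ-++ ms ns)) (sym (ℤ.+-assoc m _ _))

sumℤ-map-pos : ∀ (xs : List A) (f : A → ℕ) → sumℤ (map (λ x → ℤ.+ f x) xs) ≡ ℤ.+ ∑ xs f
sumℤ-map-pos []       f = refl
sumℤ-map-pos (x ∷ xs) f = trans (cong (ℤ._+_ (ℤ.+ f x)) (sumℤ-map-pos xs f)) (sym (ℤ.pos-+ (f x) _))

sumℤ-concatMap-map-pos : ∀ (xs : List A) (ys : List B) (f : A → B → ℕ) →
  sumℤ (concatMap (λ x → map (λ y → ℤ.+ f x y) ys) xs) ≡ ℤ.+ (∑[ x ∈ xs ] ∑[ y ∈ ys ] f x y)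
sumℤ-concatMap-map-pos []       ys f = refl
sumℤ-concatMap-map-pos (x ∷ xs) ys f =
  trans (sumℤ-++ (map (λ y → ℤ.+ f x y) ys) _)
    (trans (cong₂ ℤ._+_ (sumℤ-map-pos ys (f x)) (sumℤ-concatMap-map-pos xs ys f))
      (sym (ℤ.pos-+ (∑ ys (f x)) _)))

-- Enumerations

length-filterᵇ : ∀ (p : A → Bool) xs → length (filterᵇ p xs) ≡ ∑[ x ∈ xs ] 𝟙 (p x)
length-filterᵇ p []       = refl
length-filterᵇ p (x ∷ xs) with p x
... | true  = cong suc (length-filterᵇ p xs)
... | false = length-filterᵇ p xs

∈-allFinL : ∀ {n} (x : Fin n) → x ∈ allFinL n
∈-allFinL zero    = here refl
∈-allFinL (suc x) = there (∈-map⁺ suc (∈-allFinL x))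

module _ {n} (p : Fin n → Bool) where

  all-allFinL⁻ : T (all p (allFinL n)) → ∀ x → T (p x)
  all-allFinL⁻ h x = All.lookup (all⁺ p (allFinL n) h) (∈-allFinL x)

  all-allFinL⁺ : (∀ x → T (p x)) → T (all p (allFinL n))
  all-allFinL⁺ h = all⁻ p (All.universal h (allFinL n))

  any-allFinL⁻ : T (any p (allFinL n)) → ∃[ x ] T (p x)
  any-allFinL⁻ h = satisfied (any⁻ p (allFinL n) h)

  any-allFinL⁺ : ∀ x → T (p x) → T (any p (allFinL n))
  any-allFinL⁺ x px = any⁺ p (lose (∈-allFinL x) px)

map-allFinL-suc : ∀ {n} (f : Fin (suc n) → A) → map f (allFinL (suc n)) ≡ f zero ∷ map (f ∘ suc) (allFinL n)
map-allFinL-suc {n = n} f = cong (f zero ∷_) (sym (List.map-∘ (allFinL n)))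

toList-tabulate : ∀ {n} (f : Fin n → A) → toList (tabulate f) ≡ map f (allFinL n)
toList-tabulate {n = zero}  f = refl
toList-tabulate {n = suc n} f = trans (cong (f zero ∷_) (toList-tabulate (f ∘ suc))) (sym (map-allFinL-suc f))

allFinL-+ : ∀ m n → allFinL (m + n) ≡ map (_↑ˡ n) (allFinL m) ++ map (m ↑ʳ_) (allFinL n)
allFinL-+ zero    n = sym (List.map-id (allFinL n))
allFinL-+ (suc m) n = cong (zero ∷_) (begin
  map suc (allFinL (m + n))
    ≡⟨ cong (map suc) (allFinL-+ m n) ⟩
  map suc (map (_↑ˡ n) (allFinL m) ++ map (m ↑ʳ_) (allFinL n))
    ≡⟨ List.map-++ suc (map (_↑ˡ n) (allFinL m)) _ ⟩
  map suc (map (_↑ˡ n) (allFinL m)) ++ map suc (map (m ↑ʳ_) (allFinL n))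
    ≡⟨ cong₂ _++_ (trans (sym (List.map-∘ (allFinL m))) (List.map-∘ (allFinL m))) (sym (List.map-∘ (allFinL n))) ⟩
  map (_↑ˡ n) (map suc (allFinL m)) ++ map (suc m ↑ʳ_) (allFinL n) ∎)
  where open ≡-Reasoning

∈ᵇ-tabulate⇔ : ∀ {m n} (f : Fin m → Fin n) q →
  T (any (λ q′ → does (q′ ≟ q)) (toList (tabulate f))) ⇔ (∃[ l ] f l ≡ q)
∈ᵇ-tabulate⇔ {m} f q rewrite toList-tabulate f | sym (List.map-∘ {g = λ q′ → does (q′ ≟ q)} {f = f} (allFinL m)) = mk⇔
  (λ found → let l , fl≟q = any-allFinL⁻ _ found in l , T-does⁻ (f l ≟ q) fl≟q)
  (λ (l , fl≡q) → any-allFinL⁺ _ l (T-does⁺ (f l ≟ q) fl≡q))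

concatMap-[] : ∀ (g : A → List B) xs → (∀ x → g x ≡ []) → concatMap g xs ≡ []
concatMap-[] g []       g≡[] = refl
concatMap-[] g (x ∷ xs) g≡[] rewrite g≡[] x = concatMap-[] g xs g≡[]

lookup-ext : ∀ {n} {u w : Vec A n} → (∀ p → lookup u p ≡ lookup w p) → u ≡ w
lookup-ext {u = u} {w} u≗w = trans (sym (Vec.tabulate∘lookup u)) (trans (Vec.tabulate-cong u≗w) (Vec.tabulate∘lookup w))

tabulate-↑ˡ-++-tabulate-↑ʳ : ∀ m {n} (xs : Vec A (m + n)) →
  tabulate (lookup xs ∘ (_↑ˡ n)) Vec.++ tabulate (lookup xs ∘ (m ↑ʳ_)) ≡ xs
tabulate-↑ˡ-++-tabulate-↑ʳ zero    xs       = Vec.tabulate∘lookup xs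
tabulate-↑ˡ-++-tabulate-↑ʳ (suc m) (x ∷ xs) = cong (x ∷_) (tabulate-↑ˡ-++-tabulate-↑ʳ m xs)

toList-++-injective : ∀ {m n} (xs ys : Vec A m) (us vs : Vec A n) →
  toList xs ++ toList us ≡ toList ys ++ toList vs → xs ≡ ys × us ≡ vs
toList-++-injective xs ys us vs eq = Vec.++-injective xs ys
  (trans (sym (Vec.cast-is-id refl (xs Vec.++ us)))
         (Vec.toList-injective refl (xs Vec.++ us) (ys Vec.++ vs)
           (trans (Vec.toList-++ xs us) (trans eq (sym (Vec.toList-++ ys vs))))))

data SplitView {m n : ℕ} : Fin (m + n) → Set where
  is↑ˡ : ∀ a → SplitView (a ↑ˡ n)
  is↑ʳ : ∀ b → SplitView (m ↑ʳ b)

splitView : ∀ m {n} (x : Fin (m + n)) → SplitView {m} {n} x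
splitView m x with splitAt m x in eq
... | inj₁ a = subst SplitView (Fin.splitAt⁻¹-↑ˡ eq) (is↑ˡ a)
... | inj₂ b = subst SplitView (Fin.splitAt⁻¹-↑ʳ eq) (is↑ʳ b)

↑ˡ≢↑ʳ : ∀ {m n} (a : Fin m) (b : Fin n) → a ↑ˡ n ≢ m ↑ʳ b
↑ˡ≢↑ʳ {m} {n} a b eq = case trans (sym (Fin.splitAt-↑ˡ m a n)) (trans (cong (splitAt m) eq) (Fin.splitAt-↑ʳ m n b)) of λ ()

∑-subsets-∷ : ∀ x (xs : List A) (f : List A → ℕ) →
  ∑ (subsets (x ∷ xs)) f ≡ (∑[ S ∈ subsets xs ] f (x ∷ S)) + ∑ (subsets xs) f
∑-subsets-∷ x xs f = trans (∑-++ (map (x ∷_) (subsets xs)) _ f) (cong (_+ _) (∑-map (x ∷_) (subsets xs) f))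

∑-subsets-++ : ∀ (xs ys : List A) (f : List A → ℕ) →
  ∑ (subsets (xs ++ ys)) f ≡ ∑[ S ∈ subsets xs ] ∑[ S′ ∈ subsets ys ] f (S ++ S′)
∑-subsets-++ []       ys f = sym (ℕ.+-identityʳ _)
∑-subsets-++ (x ∷ xs) ys f = begin
  ∑ (subsets (x ∷ xs ++ ys)) f
    ≡⟨ ∑-subsets-∷ x (xs ++ ys) f ⟩
  (∑[ S ∈ subsets (xs ++ ys) ] f (x ∷ S)) + ∑ (subsets (xs ++ ys)) f
    ≡⟨ cong₂ _+_ (∑-subsets-++ xs ys (f ∘ (x ∷_))) (∑-subsets-++ xs ys f) ⟩
  (∑[ S ∈ subsets xs ] ∑[ S′ ∈ subsets ys ] f (x ∷ S ++ S′))
    + (∑[ S ∈ subsets xs ] ∑[ S′ ∈ subsets ys ] f (S ++ S′))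
    ≡⟨ ∑-subsets-∷ x xs _ ⟨
  ∑[ S ∈ subsets (x ∷ xs) ] ∑[ S′ ∈ subsets ys ] f (S ++ S′) ∎
  where open ≡-Reasoning

∑-subsets-map : ∀ (g : A → B) xs (f : List B → ℕ) →
  ∑ (subsets (map g xs)) f ≡ ∑[ S ∈ subsets xs ] f (map g S)
∑-subsets-map g []       f = refl
∑-subsets-map g (x ∷ xs) f =
  trans (∑-subsets-∷ (g x) (map g xs) f)
    (trans (cong₂ _+_ (∑-subsets-map g xs (f ∘ (g x ∷_))) (∑-subsets-map g xs f))
      (sym (∑-subsets-∷ x xs _)))

∑-subsets-mapMaybe : ∀ (g : A → Maybe B) xs (f : List B → ℕ) →
  ∑ (subsets (mapMaybe g xs)) f
    ≡ ∑[ S ∈ subsets xs ] (if all (is-just ∘ g) S then f (mapMaybe g S) else 0)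
∑-subsets-mapMaybe g []       f = refl
∑-subsets-mapMaybe g (x ∷ xs) f with g x in gx
... | just y  = trans (∑-subsets-∷ y (mapMaybe g xs) f)
                  (trans (cong₂ _+_ (∑-subsets-mapMaybe g xs (f ∘ (y ∷_))) (∑-subsets-mapMaybe g xs f))
                    (sym (trans (∑-subsets-∷ x xs _) (cong (_+ _) (∑-cong (subsets xs) summand-∷)))))
  where
  summand-∷ : ∀ S → (if all (is-just ∘ g) (x ∷ S) then f (mapMaybe g (x ∷ S)) else 0)
                 ≡ (if all (is-just ∘ g) S then f (y ∷ mapMaybe g S) else 0)
  summand-∷ S rewrite gx = refl
... | nothing = trans (∑-subsets-mapMaybe g xs f)
                  (sym (trans (∑-subsets-∷ x xs _) (cong (_+ _) (∑-zero (subsets xs) summand-∷))))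
  where
  summand-∷ : ∀ S → (if all (is-just ∘ g) (x ∷ S) then f (mapMaybe g (x ∷ S)) else 0) ≡ 0
  summand-∷ S rewrite gx = refl

∑-allWords-single : ∀ r (f : Vec YN r → ℕ) w → (∀ u → u ≢ w → f u ≡ 0) → ∑ (allWords r) f ≡ f w
∑-allWords-single zero    f [] _     = ℕ.+-identityʳ (f [])
∑-allWords-single (suc r) f (a ∷ w) f≡0 =
  trans (∑-concatMap (λ u → (Y ∷ u) ∷ (N ∷ u) ∷ []) (allWords r) f)
    (trans (∑-allWords-single r _ w both≡0) (both≡ a f≡0))
  where
  both≡0 : ∀ u → u ≢ w → f (Y ∷ u) + (f (N ∷ u) + 0) ≡ 0
  both≡0 u u≢w = cong₂ _+_ (f≡0 _ (u≢w ∘ proj₂ ∘ Vec.∷-injective))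
                           (cong (_+ 0) (f≡0 _ (u≢w ∘ proj₂ ∘ Vec.∷-injective)))
  both≡ : ∀ a → (∀ u → u ≢ a ∷ w → f u ≡ 0) → f (Y ∷ w) + (f (N ∷ w) + 0) ≡ f (a ∷ w)
  both≡ Y f≡0 = trans (cong (_+_ (f (Y ∷ w))) (trans (ℕ.+-identityʳ _) (f≡0 _ λ ()))) (ℕ.+-identityʳ _)
  both≡ N f≡0 = trans (cong (_+ (f (N ∷ w) + 0)) (f≡0 _ λ ())) (ℕ.+-identityʳ _)

-- Renumbering vertices

module _ {A : Set} where

  compress-agrees : ∀ n (f : Fin n → Maybe A) x → [ just , const nothing ] (proj₂ (compress n f) x) ≡ f x
  compress-agrees (suc n) f zero with compress n (f ∘ suc) | f zero
  ... | _ | just _  = refl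
  ... | _ | nothing = refl
  compress-agrees (suc n) f (suc x) with compress n (f ∘ suc) | compress-agrees n (f ∘ suc) x | f zero
  ... | _     | agrees | just _  = agrees
  ... | _ , h | agrees | nothing = trans ([,]-map (h x)) agrees

  compress-surjective : ∀ n (f : Fin n → Maybe A) y → ∃[ x ] proj₂ (compress n f) x ≡ inj₂ y
  compress-surjective (suc n) f y with compress n (f ∘ suc) | compress-surjective n (f ∘ suc) | f zero
  ... | _ | onto | just _ = let x , hx = onto y in suc x , hx
  ... | _ | onto | nothing with y
  ...   | zero   = zero , refl
  ...   | suc y′ = let x , hx = onto y′ in suc x , cong (Sum.map₂ suc) hx

  private
    shift : ∀ {m} → A ⊎ Fin m → A ⊎ Fin (suc m)
    shift = Sum.map₂ suc

    shift-inj₂ : ∀ {m} (u : A ⊎ Fin m) {z} → shift u ≡ inj₂ z → ∃[ z′ ] u ≡ inj₂ z′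
    shift-inj₂ (inj₂ z′) _ = z′ , refl

    shift-≢-zero : ∀ {m} (u : A ⊎ Fin m) → shift u ≢ inj₂ zero
    shift-≢-zero (inj₁ _) ()
    shift-≢-zero (inj₂ _) ()

    shift-injective : ∀ {m} {u u′ : A ⊎ Fin m} → shift u ≡ shift u′ → u ≡ u′
    shift-injective {u = inj₁ _} {inj₁ _} refl = refl
    shift-injective {u = inj₂ _} {inj₂ _} e    = cong inj₂ (Fin.suc-injective (inj₂-injective e))

  compress-injective : ∀ n (f : Fin n → Maybe A) {x x′ z} → let h = proj₂ (compress n f) in
    h x ≡ inj₂ z → h x ≡ h x′ → x ≡ x′
  compress-injective (suc n) f {zero} {zero} _ _ = refl
  compress-injective (suc n) f {zero} {suc x′} with compress n (f ∘ suc) | f zero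
  ... | _     | just _  = λ ()
  ... | _ , h | nothing = λ _ e → ⊥-elim (shift-≢-zero (h x′) (sym e))
  compress-injective (suc n) f {suc x} {zero} with compress n (f ∘ suc) | f zero
  ... | _     | just _  = λ hx e → case trans (sym hx) e of λ ()
  ... | _ , h | nothing = λ _ e → ⊥-elim (shift-≢-zero (h x) e)
  compress-injective (suc n) f {suc x} {suc x′} with compress n (f ∘ suc) | compress-injective n (f ∘ suc) {x} {x′} | f zero
  ... | _     | injective | just _  = λ hx e → cong suc (injective hx e)
  ... | _ , h | injective | nothing = λ hx e → cong suc (injective (proj₂ (shift-inj₂ (h x) hx)) (shift-injective e))

module _ {n : ℕ} {X : Set} where

  glueLookup-just : ∀ j (at : Fin j → Fin n) (val : Fin j → X) {x a} →
    glueLookup j at val x ≡ just a → ∃[ l ] at l ≡ x × val l ≡ a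
  glueLookup-just (suc j) at val {x} found with at zero ≟ x
  glueLookup-just (suc j) at val refl | yes at₀≡x = zero , at₀≡x , refl
  ... | no _ = let l , atl≡x , vall≡a = glueLookup-just j (at ∘ suc) (val ∘ suc) found in suc l , atl≡x , vall≡a

  glueLookup-at : ∀ j (at : Fin j → Fin n) (val : Fin j → X) → Injective _≡_ _≡_ at →
    ∀ l → glueLookup j at val (at l) ≡ just (val l)
  glueLookup-at (suc j) at val at-inj l with at zero ≟ at l
  glueLookup-at (suc j) at val at-inj zero    | yes _   = refl
  glueLookup-at (suc j) at val at-inj (suc l) | yes eq  = case at-inj eq of λ ()
  glueLookup-at (suc j) at val at-inj zero    | no  neq = ⊥-elim (neq refl)
  glueLookup-at (suc j) at val at-inj (suc l) | no  _   =
    glueLookup-at j (at ∘ suc) (val ∘ suc) (Fin.suc-injective ∘ at-inj) l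

-- Perfect matchings of vertex-deleted graphs

hit : ∀ {n} → Fin n → Fin n → ℕ
hit v a = if does (a ≟ v) then 1 else 0

hit-cong : ∀ {n n′} {v a : Fin n} {v′ a′ : Fin n′} →
  (a ≡ v → a′ ≡ v′) → (a′ ≡ v′ → a ≡ v) → hit v a ≡ hit v′ a′
hit-cong {v = v} {a} {v′} {a′} to from with a ≟ v | a′ ≟ v′
... | yes _ | yes _ = refl
... | no  _ | no  _ = refl
... | yes p | no  q = ⊥-elim (q (to p))
... | no  p | yes q = ⊥-elim (p (from q))

hit-≢ : ∀ {n} {v a : Fin n} → a ≢ v → hit v a ≡ 0
hit-≢ {v = v} {a} a≢v = cong (if_then 1 else 0) (dec-false (a ≟ v) a≢v)

hit-self : ∀ {n} (v : Fin n) → hit v v ≡ 1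
hit-self v = cong (if_then 1 else 0) (dec-true (v ≟ v) refl)

Edges : ℕ → Set
Edges n = List (Fin n × Fin n)

deg-++ : ∀ {n} (S S′ : Edges n) v → deg (S ++ S′) v ≡ deg S v + deg S′ v
deg-++ []            S′ v = refl
deg-++ ((a , b) ∷ S) S′ v = trans (cong (_+_ (hit v a + hit v b)) (deg-++ S S′ v)) (sym (ℕ.+-assoc (hit v a + hit v b) _ _))

module _ {n n′} (g : Fin n → Fin n′) where

  deg-map-injective : Injective _≡_ _≡_ g → ∀ S y → deg (map (Prod.map g g) S) (g y) ≡ deg S y
  deg-map-injective g-inj []            y = refl
  deg-map-injective g-inj ((a , b) ∷ S) y =
    cong₂ _+_ (cong₂ _+_ (hit-cong g-inj (cong g)) (hit-cong g-inj (cong g))) (deg-map-injective g-inj S y)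

  deg-map-∉ : ∀ x → (∀ y → g y ≢ x) → ∀ S → deg (map (Prod.map g g) S) x ≡ 0
  deg-map-∉ x x∉g []            = refl
  deg-map-∉ x x∉g ((a , b) ∷ S) = cong₂ _+_ (cong₂ _+_ (hit-≢ (x∉g a)) (hit-≢ (x∉g b))) (deg-map-∉ x x∉g S)

demand : Bool → ℕ
demand true  = 0
demand false = 1

isPerfectMatchingMinus : (G : Graph) → (Fin (V G) → Bool) → Edges (V G) → Bool
isPerfectMatchingMinus G del S = all (λ x → deg S x ≡ᵇ demand (del x)) (allFinL (V G))

all-≡ᵇ⇔ : ∀ {n} (f g : Fin n → ℕ) → T (all (λ x → f x ≡ᵇ g x) (allFinL n)) ⇔ (∀ x → f x ≡ g x)
all-≡ᵇ⇔ f g = mk⇔ (λ h x → ℕ.≡ᵇ⇒≡ _ _ (all-allFinL⁻ _ h x))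
                  (λ h → all-allFinL⁺ _ (λ x → ℕ.≡⇒≡ᵇ _ _ (h x)))

isPerfectMatching⇔ : ∀ G S → T (isPerfectMatching G S) ⇔ (∀ x → deg S x ≡ 1)
isPerfectMatching⇔ G S = all-≡ᵇ⇔ (deg S) (λ _ → 1)

isPerfectMatchingMinus⇔ : ∀ G del S → T (isPerfectMatchingMinus G del S) ⇔ (∀ x → deg S x ≡ demand (del x))
isPerfectMatchingMinus⇔ G del S = all-≡ᵇ⇔ (deg S) (demand ∘ del)

bothInj₂ : ∀ {A B : Set} → A ⊎ B → A ⊎ B → Maybe (B × B)
bothInj₂ (inj₂ a) (inj₂ b) = just (a , b)
bothInj₂ _        _        = nothing

module Deletion (G : Graph) (del : Fin (V G) → Bool) where

  m : ℕ
  m = proj₁ (compress (V G) (λ x → if del x then just tt else nothing))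

  h : Fin (V G) → ⊤ ⊎ Fin m
  h = proj₂ (compress (V G) (λ x → if del x then just tt else nothing))

  keep : Fin (V G) × Fin (V G) → Maybe (Fin m × Fin m)
  keep (a , b) = bothInj₂ (h a) (h b)

  private
    -- names the edge filter that deleteV defines locally, so that it can be compared with keep
    deleteV-keeps : ∃[ K ] E (deleteV G del) ≡ mapMaybe K (E G)
    deleteV-keeps = _ , refl

    deleteV-keeps-keep : ∀ e → proj₁ deleteV-keeps e ≡ keep e
    deleteV-keeps-keep (a , b) with h a | h b
    ... | inj₁ _ | _      = refl
    ... | inj₂ _ | inj₁ _ = refl
    ... | inj₂ _ | inj₂ _ = refl

  E-deleteV : E (deleteV G del) ≡ mapMaybe keep (E G)
  E-deleteV = trans (proj₂ deleteV-keeps) (cong catMaybes (List.map-cong deleteV-keeps-keep (E G)))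

  h-deleted : ∀ {x} → h x ≡ inj₁ tt → del x ≡ true
  h-deleted {x} hx with del x | compress-agrees (V G) (λ x → if del x then just tt else nothing) x
  ... | true  | _ = refl
  ... | false | agrees rewrite hx = case agrees of λ ()

  h-kept : ∀ {x y} → h x ≡ inj₂ y → del x ≡ false
  h-kept {x} hx with del x | compress-agrees (V G) (λ x → if del x then just tt else nothing) x
  ... | false | _ = refl
  ... | true  | agrees rewrite hx = case agrees of λ ()

  allKept : Edges (V G) → Bool
  allKept = all (is-just ∘ keep)

  private
    hit-keep : ∀ {a a′ x y} → h a ≡ inj₂ a′ → h x ≡ inj₂ y → hit y a′ ≡ hit x a
    hit-keep ha hx =
      hit-cong (λ a′≡y → compress-injective (V G) _ ha (trans ha (trans (cong inj₂ a′≡y) (sym hx))))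
               (λ a≡x → inj₂-injective (trans (sym ha) (trans (cong h a≡x) hx)))

    hit-deleted : ∀ {a a′ x} → h a ≡ inj₂ a′ → h x ≡ inj₁ tt → hit x a ≡ 0
    hit-deleted {a} {x = x} ha hx = hit-≢ {v = x} {a} λ { refl → case trans (sym ha) hx of λ () }

  deg-keep : ∀ S {x y} → T (allKept S) → h x ≡ inj₂ y → deg (mapMaybe keep S) y ≡ deg S x
  deg-keep []            _  _  = refl
  deg-keep ((a , b) ∷ S) ok hx with h a in ha | h b in hb
  deg-keep ((a , b) ∷ S) () hx | inj₁ _  | _
  deg-keep ((a , b) ∷ S) () hx | inj₂ _  | inj₁ _
  deg-keep ((a , b) ∷ S) ok hx | inj₂ a′ | inj₂ b′ =
    cong₂ _+_ (cong₂ _+_ (hit-keep ha hx) (hit-keep hb hx)) (deg-keep S ok hx)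

  deg-deleted : ∀ S {x} → T (allKept S) → h x ≡ inj₁ tt → deg S x ≡ 0
  deg-deleted []            _  _  = refl
  deg-deleted ((a , b) ∷ S) ok hx with h a in ha | h b in hb
  deg-deleted ((a , b) ∷ S) () hx | inj₁ _  | _
  deg-deleted ((a , b) ∷ S) () hx | inj₂ _  | inj₁ _
  deg-deleted ((a , b) ∷ S) ok hx | inj₂ a′ | inj₂ b′ =
    cong₂ _+_ (cong₂ _+_ (hit-deleted ha hx) (hit-deleted hb hx)) (deg-deleted S ok hx)

  allKept-intro : ∀ S → (∀ x → h x ≡ inj₁ tt → deg S x ≡ 0) → T (allKept S)
  allKept-intro []            _        = _
  allKept-intro ((a , b) ∷ S) deleted₀ with h a in ha | h b in hb
  ... | inj₁ tt | _       =
    case trans (sym (hit-self a)) (ℕ.m+n≡0⇒m≡0 _ (ℕ.m+n≡0⇒m≡0 _ (deleted₀ a ha))) of λ ()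
  ... | inj₂ _  | inj₁ tt =
    case trans (sym (hit-self b)) (ℕ.m+n≡0⇒n≡0 (hit b a) (ℕ.m+n≡0⇒m≡0 _ (deleted₀ b hb))) of λ ()
  ... | inj₂ _  | inj₂ _  = allKept-intro S (λ x hx → ℕ.m+n≡0⇒n≡0 (hit x a + hit x b) (deleted₀ x hx))

  private
    h-view : ∀ x → h x ≡ inj₁ tt ⊎ ∃[ y ] h x ≡ inj₂ y
    h-view x with h x
    ... | inj₁ tt = inj₁ refl
    ... | inj₂ y  = inj₂ (y , refl)

  isPerfectMatching-deleteV⇔ : ∀ S →
    T (allKept S ∧ isPerfectMatching (deleteV G del) (mapMaybe keep S)) ⇔ T (isPerfectMatchingMinus G del S)
  isPerfectMatching-deleteV⇔ S = mk⇔
    (λ ok∧pm → let ok , pm = Equivalence.to T-∧ ok∧pm in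
      Equivalence.from (isPerfectMatchingMinus⇔ G del S)
        (covered ok (Equivalence.to (isPerfectMatching⇔ (deleteV G del) (mapMaybe keep S)) pm)))
    (λ pmm → let covers = Equivalence.to (isPerfectMatchingMinus⇔ G del S) pmm
                 ok     = allKept-intro S (λ x hx → trans (covers x) (cong demand (h-deleted hx))) in
      Equivalence.from T-∧ (ok , Equivalence.from (isPerfectMatching⇔ (deleteV G del) (mapMaybe keep S)) (matched covers ok)))
    where
    covered : T (allKept S) → (∀ y → deg (mapMaybe keep S) y ≡ 1) → ∀ x → deg S x ≡ demand (del x)
    covered ok pm x with h-view x
    ... | inj₁ hx       = trans (deg-deleted S ok hx) (cong demand (sym (h-deleted hx)))
    ... | inj₂ (y , hx) = trans (sym (deg-keep S ok hx)) (trans (pm y) (cong demand (sym (h-kept hx))))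

    matched : (∀ x → deg S x ≡ demand (del x)) → T (allKept S) → ∀ y → deg (mapMaybe keep S) y ≡ 1
    matched covers ok y =
      let x , hx = compress-surjective (V G) _ y in trans (deg-keep S ok hx) (trans (covers x) (cong demand (h-kept hx)))

pmCount-deleteV : ∀ G del → pmCount (deleteV G del) ≡ ∑[ S ∈ subsets (E G) ] 𝟙 (isPerfectMatchingMinus G del S)
pmCount-deleteV G del = begin
  pmCount (deleteV G del)
    ≡⟨ length-filterᵇ _ (subsets (E (deleteV G del))) ⟩
  ∑[ S ∈ subsets (E (deleteV G del)) ] 𝟙 (isPerfectMatching (deleteV G del) S)
    ≡⟨ cong (λ es → ∑[ S ∈ subsets es ] 𝟙 (isPerfectMatching (deleteV G del) S)) E-deleteV ⟩
  ∑[ S ∈ subsets (mapMaybe keep (E G)) ] 𝟙 (isPerfectMatching (deleteV G del) S)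
    ≡⟨ ∑-subsets-mapMaybe keep (E G) _ ⟩
  ∑[ S ∈ subsets (E G) ] (if allKept S then 𝟙 (isPerfectMatching (deleteV G del) (mapMaybe keep S)) else 0)
    ≡⟨ ∑-cong (subsets (E G)) (λ S → trans (if-𝟙 (allKept S) _)
         (cong 𝟙 (T-injective (Equivalence.to (isPerfectMatching-deleteV⇔ S))
                              (Equivalence.from (isPerfectMatching-deleteV⇔ S))))) ⟩
  ∑[ S ∈ subsets (E G) ] 𝟙 (isPerfectMatchingMinus G del S) ∎
  where
  open ≡-Reasoning
  open Deletion G del

-- Pointed graphs and their words

deletedBy : ∀ {r} (P : Pointed r) → Vec YN r → Fin (V (gr P)) → Bool
deletedBy {r} P ε x = any (λ p → does (pts P p ≟ x) ∧ isY (lookup ε p)) (allFinL r)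

realises : ∀ {r} (P : Pointed r) → Vec YN r → Edges (V (gr P)) → Bool
realises P ε = isPerfectMatchingMinus (gr P) (deletedBy P ε)

realisations : ∀ {r} (P : Pointed r) → Vec YN r → ℕ
realisations P ε = ∑[ S ∈ subsets (E (gr P)) ] 𝟙 (realises P ε S)

stateSum≡realisations : ∀ {r} (P : Pointed r) ε → stateSum P ε ≡ ℤ.+ realisations P ε
stateSum≡realisations P ε = cong ℤ.+_ (pmCount-deleteV (gr P) (deletedBy P ε))

label : ℕ → YN
label zero    = Y
label (suc _) = N

label-demand : ∀ y → label (demand (isY y)) ≡ y
label-demand Y = refl
label-demand N = refl

stateOf : ∀ {r} (P : Pointed r) → Edges (V (gr P)) → Vec YN r
stateOf P S = tabulate (λ p → label (deg S (pts P p)))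

Unpointed : ∀ {r} (P : Pointed r) → Fin (V (gr P)) → Set
Unpointed P x = ∀ p → pts P p ≢ x

admissible : ∀ {r} (P : Pointed r) → Edges (V (gr P)) → Bool
admissible P S = realises P (stateOf P S) S

≡demand⇔ : ∀ d o → d ≡ demand (isY o) ⇔ (d ≤ 1 × label d ≡ o)
≡demand⇔ d o = mk⇔ (to d o) (from d o)
  where
  to : ∀ d o → d ≡ demand (isY o) → d ≤ 1 × label d ≡ o
  to _ Y refl = z≤n , refl
  to _ N refl = s≤s z≤n , refl
  from : ∀ d o → d ≤ 1 × label d ≡ o → d ≡ demand (isY o)
  from 0             _ (_ , refl)     = refl
  from 1             _ (_ , refl)     = refl
  from (suc (suc _)) _ (s≤s () , _)

+≡demand⇔ : ∀ d₁ d₂ o →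
  d₁ + d₂ ≡ demand (isY o) ⇔ (d₁ ≤ 1 × d₂ ≤ 1 × mulYN (label d₁) (label d₂) ≡ just o)
+≡demand⇔ d₁ d₂ o = mk⇔ (to d₁ d₂ o) (from d₁ d₂ o)
  where
  to : ∀ d₁ d₂ o → d₁ + d₂ ≡ demand (isY o) → d₁ ≤ 1 × d₂ ≤ 1 × mulYN (label d₁) (label d₂) ≡ just o
  to 0 0 Y refl = z≤n , z≤n , refl
  to 0 1 N refl = z≤n , s≤s z≤n , refl
  to 1 0 N refl = s≤s z≤n , z≤n , refl
  to 0 (suc _)       Y ()
  to 0 0             N ()
  to 0 (suc (suc _)) N ()
  to (suc _) _       Y ()
  to 1 (suc _)       N ()
  to (suc (suc _)) _ N ()
  from : ∀ d₁ d₂ o → d₁ ≤ 1 × d₂ ≤ 1 × mulYN (label d₁) (label d₂) ≡ just o → d₁ + d₂ ≡ demand (isY o)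
  from 0 0 _ (_ , _ , refl) = refl
  from 0 1 _ (_ , _ , refl) = refl
  from 1 0 _ (_ , _ , refl) = refl
  from 1 1 _ (_ , _ , ())
  from (suc (suc _)) _ _ (s≤s () , _)
  from _ (suc (suc _)) _ (_ , s≤s () , _)

module PointedInjective {r} (P : Pointed r) (pts-injective : Injective _≡_ _≡_ (pts P)) where

  pointed? : ∀ x → ∃[ p ] pts P p ≡ x ⊎ Unpointed P x
  pointed? x with Fin.any? (λ p → pts P p ≟ x)
  ... | yes p,px = inj₁ p,px
  ... | no  ¬p   = inj₂ (λ p px → ¬p (p , px))

  deletedBy-pts : ∀ ε p → deletedBy P ε (pts P p) ≡ isY (lookup ε p)
  deletedBy-pts ε p = T-injective
    (λ del → let p′ , hit∧y = any-allFinL⁻ _ del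
                 p′≡p , y    = Equivalence.to T-∧ hit∧y in
             subst (T ∘ isY ∘ lookup ε) (pts-injective (T-does⁻ (pts P p′ ≟ pts P p) p′≡p)) y)
    (λ y → any-allFinL⁺ _ p (Equivalence.from T-∧ (T-does⁺ (pts P p ≟ pts P p) refl , y)))

  deletedBy-unpointed : ∀ ε {x} → Unpointed P x → deletedBy P ε x ≡ false
  deletedBy-unpointed ε {x} x∉ = ¬T⇒≡false λ del →
    let p , hit∧y = any-allFinL⁻ _ del in x∉ p (T-does⁻ (pts P p ≟ x) (proj₁ (Equivalence.to T-∧ hit∧y)))

  realises⇔ : ∀ ε S → T (realises P ε S) ⇔
    ((∀ p → deg S (pts P p) ≡ demand (isY (lookup ε p))) × (∀ x → Unpointed P x → deg S x ≡ 1))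
  realises⇔ ε S = mk⇔
    (λ re → let covers = Equivalence.to (isPerfectMatchingMinus⇔ (gr P) (deletedBy P ε) S) re in
      (λ p → trans (covers (pts P p)) (cong demand (deletedBy-pts ε p))) ,
      (λ x x∉ → trans (covers x) (cong demand (deletedBy-unpointed ε x∉))))
    (λ (at-pts , off-pts) → Equivalence.from (isPerfectMatchingMinus⇔ (gr P) (deletedBy P ε) S) (covers at-pts off-pts))
    where
    covers : (∀ p → deg S (pts P p) ≡ demand (isY (lookup ε p))) → (∀ x → Unpointed P x → deg S x ≡ 1) →
             ∀ x → deg S x ≡ demand (deletedBy P ε x)
    covers at-pts off-pts x with pointed? x
    ... | inj₁ (p , refl) = trans (at-pts p) (cong demand (sym (deletedBy-pts ε p)))
    ... | inj₂ x∉         = trans (off-pts x x∉) (cong demand (sym (deletedBy-unpointed ε x∉)))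

  realises⇒≡stateOf : ∀ ε S → T (realises P ε S) → ε ≡ stateOf P S
  realises⇒≡stateOf ε S re = trans (sym (Vec.tabulate∘lookup ε)) (Vec.tabulate-cong λ p →
    trans (sym (label-demand (lookup ε p))) (cong label (sym (proj₁ (Equivalence.to (realises⇔ ε S) re) p))))

  admissible⇔ : ∀ S → T (admissible P S) ⇔ ((∀ p → deg S (pts P p) ≤ 1) × (∀ x → Unpointed P x → deg S x ≡ 1))
  admissible⇔ S = mk⇔
    (Prod.map₁ (λ at-pts p → proj₁ (Equivalence.to (≡demand⇔ _ _) (trans (at-pts p) (label-of p))))
      ∘ Equivalence.to (realises⇔ (stateOf P S) S))
    (Equivalence.from (realises⇔ (stateOf P S) S)
      ∘ Prod.map₁ (λ ≤1 p → trans (Equivalence.from (≡demand⇔ _ _) (≤1 p , refl)) (sym (label-of p))))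
    where
    label-of : ∀ p → demand (isY (lookup (stateOf P S) p)) ≡ demand (isY (label (deg S (pts P p))))
    label-of p = cong (demand ∘ isY) (Vec.lookup∘tabulate _ p)

  ∑-realisations : ∀ (F : Vec YN r → ℕ) →
    ∑[ ε ∈ allWords r ] realisations P ε * F ε ≡ ∑[ S ∈ subsets (E (gr P)) ] 𝟙 (admissible P S) * F (stateOf P S)
  ∑-realisations F = begin
    ∑[ ε ∈ allWords r ] realisations P ε * F ε
      ≡⟨ ∑-cong (allWords r) (λ ε → ∑-*ʳ (F ε) (subsets (E (gr P))) _) ⟩
    ∑[ ε ∈ allWords r ] ∑[ S ∈ subsets (E (gr P)) ] 𝟙 (realises P ε S) * F ε
      ≡⟨ ∑-comm (allWords r) (subsets (E (gr P))) _ ⟩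
    ∑[ S ∈ subsets (E (gr P)) ] ∑[ ε ∈ allWords r ] 𝟙 (realises P ε S) * F ε
      ≡⟨ ∑-cong (subsets (E (gr P))) (λ S → ∑-allWords-single r _ (stateOf P S) (λ ε ε≢ →
           cong (λ b → 𝟙 b * F ε) (¬T⇒≡false (ε≢ ∘ realises⇒≡stateOf ε S)))) ⟩
    ∑[ S ∈ subsets (E (gr P)) ] 𝟙 (admissible P S) * F (stateOf P S) ∎
    where open ≡-Reasoning

-- The internal multiplication

zipPairs : ∀ {a b s} → Vec (Fin a) s → Vec (Fin b) s → List (Fin a × Fin b)
zipPairs []       []       = []
zipPairs (p ∷ ps) (q ∷ qs) = (p , q) ∷ zipPairs ps qs

mulAt : ∀ {a b} → Vec YN b → Fin a × Fin b → Maybe (Vec YN a) → Maybe (Vec YN a)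
mulAt η (p , q) acc = acc >>= λ e → mulYN (lookup e p) (lookup η q) >>= λ c → just (e [ p ]≔ c)

foldMul : ∀ {a b s} → Vec (Fin a) s → Vec (Fin b) s → Vec YN a → Vec YN b → Maybe (Vec YN a)
foldMul I J ε η = foldr (mulAt η) (just ε) (zipPairs I J)

unmatched : ∀ {b s} → Vec (Fin b) s → Vec YN b → List YN
unmatched {b} J η = concatMap (λ q → if any (λ q′ → does (q′ ≟ q)) (toList J) then [] else lookup η q ∷ []) (allFinL b)

private
  foldMul-local : ∀ {a b n s} (I⁺ : Vec (Fin a) n) (J⁺ : Vec (Fin b) n) ε η (I : Vec (Fin a) s) (J : Vec (Fin b) s) →
    _ ≡ foldMul I J ε η

-- combine folds over its own local copy of zipPairs, whose lambda-lifted parameters are combine's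
-- arguments. The with separates those parameters from the recursion arguments (and makes _>>=_
-- rigid), so the meta in the type of foldMul-local is solved by pattern unification at its use.
combine≡ : ∀ {a b s} (I : Vec (Fin a) s) (J : Vec (Fin b) s) ε η →
  combine I J ε η ≡ Maybe.map (λ e → toList e ++ unmatched J η) (foldMul I J ε η)
combine≡ [] [] ε η = refl
combine≡ {a} {s = suc s} (x ∷ I) (y ∷ J) ε η with suc s | x ∷ I | y ∷ J | _>>=_ {A = Vec YN a} {B = Vec YN a}
... | _ | I⁺ | J⁺ | bind = cong (λ m → Maybe.map _ (bind m _)) (foldMul-local I⁺ J⁺ ε η I J)

foldMul-local I⁺ J⁺ ε η []      []      = refl
foldMul-local I⁺ J⁺ ε η (x ∷ I) (y ∷ J) = cong (mulAt η (x , y)) (foldMul-local I⁺ J⁺ ε η I J)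

MultipliedAlong : ∀ {a b s} → (Fin s → Fin a) → (Fin s → Fin b) → Vec YN a → Vec YN b → Vec YN a → Set
MultipliedAlong f g ε η e =
  (∀ l → mulYN (lookup ε (f l)) (lookup η (g l)) ≡ just (lookup e (f l))) ×
  (∀ p → (∀ l → f l ≢ p) → lookup e p ≡ lookup ε p)

module _ {a b : ℕ} (η : Vec YN b) where

  foldMul-tabulate⁻ : ∀ {s} (f : Fin s → Fin a) (g : Fin s → Fin b) → Injective _≡_ _≡_ f → ∀ ε e →
    foldMul (tabulate f) (tabulate g) ε η ≡ just e → MultipliedAlong f g ε η e
  foldMul-tabulate⁻ {zero}  f g f-inj ε e refl = (λ ()) , (λ _ _ → refl)
  foldMul-tabulate⁻ {suc s} f g f-inj ε e fold≡ with foldMul (tabulate (f ∘ suc)) (tabulate (g ∘ suc)) ε η in fold′≡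
  foldMul-tabulate⁻ {suc s} f g f-inj ε e () | nothing
  ... | just e′ with mulYN (lookup e′ (f zero)) (lookup η (g zero)) in f₀g₀ | fold≡
  ...   | nothing | ()
  ...   | just c  | refl = multiplied , untouched
    where
    IH : MultipliedAlong (f ∘ suc) (g ∘ suc) ε η e′
    IH = foldMul-tabulate⁻ (f ∘ suc) (g ∘ suc) (Fin.suc-injective ∘ f-inj) ε e′ fold′≡
    f-suc≢f₀ : ∀ l → f (suc l) ≢ f zero
    f-suc≢f₀ l eq = case f-inj eq of λ ()
    multiplied : ∀ l → mulYN (lookup ε (f l)) (lookup η (g l)) ≡ just (lookup (e′ [ f zero ]≔ c) (f l))
    multiplied zero    = trans (cong (λ x → mulYN x _) (sym (proj₂ IH (f zero) f-suc≢f₀)))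
                               (trans f₀g₀ (cong just (sym (Vec.lookup∘update (f zero) e′ c))))
    multiplied (suc l) = trans (proj₁ IH l) (cong just (sym (Vec.lookup∘update′ (f-suc≢f₀ l) e′ c)))
    untouched : ∀ p → (∀ l → f l ≢ p) → lookup (e′ [ f zero ]≔ c) p ≡ lookup ε p
    untouched p p∉f = trans (Vec.lookup∘update′ (p∉f zero ∘ sym) e′ c) (proj₂ IH p (p∉f ∘ suc))

  foldMul-tabulate⁺ : ∀ {s} (f : Fin s → Fin a) (g : Fin s → Fin b) → Injective _≡_ _≡_ f → ∀ ε e →
    MultipliedAlong f g ε η e → foldMul (tabulate f) (tabulate g) ε η ≡ just e
  foldMul-tabulate⁺ {zero}  f g f-inj ε e (_ , untouched) = cong just (lookup-ext λ p → sym (untouched p λ ()))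
  foldMul-tabulate⁺ {suc s} f g f-inj ε e (multiplied , untouched) = begin
    mulAt η (f zero , g zero) (foldMul (tabulate (f ∘ suc)) (tabulate (g ∘ suc)) ε η)
      ≡⟨ cong (mulAt η _)
           (foldMul-tabulate⁺ (f ∘ suc) (g ∘ suc) (Fin.suc-injective ∘ f-inj) ε e′ (multiplied′ , untouched′)) ⟩
    (mulYN (lookup e′ (f zero)) (lookup η (g zero)) >>= λ c → just (e′ [ f zero ]≔ c))
      ≡⟨ cong (λ x → mulYN x (lookup η (g zero)) >>= update) (Vec.lookup∘update (f zero) e _) ⟩
    (mulYN (lookup ε (f zero)) (lookup η (g zero)) >>= λ c → just (e′ [ f zero ]≔ c))
      ≡⟨ cong (_>>= update) (multiplied zero) ⟩
    just (e′ [ f zero ]≔ lookup e (f zero))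
      ≡⟨ cong just (trans (Vec.[]≔-idempotent e (f zero)) (Vec.[]≔-lookup e (f zero))) ⟩
    just e ∎
    where
    open ≡-Reasoning
    e′ : Vec YN a
    e′ = e [ f zero ]≔ lookup ε (f zero)
    update : YN → Maybe (Vec YN a)
    update c = just (e′ [ f zero ]≔ c)
    f-suc≢f₀ : ∀ l → f (suc l) ≢ f zero
    f-suc≢f₀ l eq = case f-inj eq of λ ()
    multiplied′ : ∀ l → mulYN (lookup ε (f (suc l))) (lookup η (g (suc l))) ≡ just (lookup e′ (f (suc l)))
    multiplied′ l = trans (multiplied (suc l)) (cong just (sym (Vec.lookup∘update′ (f-suc≢f₀ l) e _)))
    untouched′ : ∀ p → (∀ l → f (suc l) ≢ p) → lookup e′ p ≡ lookup ε p
    untouched′ p p∉f with p ≟ f zero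
    ... | yes refl = Vec.lookup∘update (f zero) e _
    ... | no  p≢f₀ = trans (Vec.lookup∘update′ p≢f₀ e _) (untouched p λ { zero → p≢f₀ ∘ sym ; (suc l) → p∉f l })

unmatched-tabulate-↑ˡ : ∀ j k (η : Vec YN (j + k)) →
  unmatched (tabulate (_↑ˡ k)) η ≡ toList (tabulate (lookup η ∘ (j ↑ʳ_)))
unmatched-tabulate-↑ˡ j k η = begin
  concatMap entry (allFinL (j + k))
    ≡⟨ cong (concatMap entry) (allFinL-+ j k) ⟩
  concatMap entry (map (_↑ˡ k) (allFinL j) ++ map (j ↑ʳ_) (allFinL k))
    ≡⟨ List.concatMap-++ entry (map (_↑ˡ k) (allFinL j)) _ ⟩
  concatMap entry (map (_↑ˡ k) (allFinL j)) ++ concatMap entry (map (j ↑ʳ_) (allFinL k))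
    ≡⟨ cong₂ _++_ (trans (List.concatMap-map entry (_↑ˡ k) (allFinL j)) (concatMap-[] _ (allFinL j) dropped))
                  (trans (List.concatMap-map entry (j ↑ʳ_) (allFinL k))
                         (trans (List.concatMap-cong kept (allFinL k))
                                (trans (sym (List.concatMap-map (_∷ []) (lookup η ∘ (j ↑ʳ_)) (allFinL k)))
                                       (List.concatMap-pure _)))) ⟩
  map (lookup η ∘ (j ↑ʳ_)) (allFinL k)
    ≡⟨ toList-tabulate _ ⟨
  toList (tabulate (lookup η ∘ (j ↑ʳ_))) ∎
  where
  open ≡-Reasoning
  matched : Fin (j + k) → Bool
  matched q = any (λ q′ → does (q′ ≟ q)) (toList (tabulate (_↑ˡ k)))
  entry : Fin (j + k) → List YN
  entry q = if matched q then [] else lookup η q ∷ []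
  dropped : ∀ l → entry (l ↑ˡ k) ≡ []
  dropped l rewrite T-injective {matched (l ↑ˡ k)} {true} (λ _ → _)
                      (λ _ → Equivalence.from (∈ᵇ-tabulate⇔ (_↑ˡ k) (l ↑ˡ k)) (l , refl)) = refl
  kept : ∀ q → entry (j ↑ʳ q) ≡ lookup η (j ↑ʳ q) ∷ []
  kept q rewrite ¬T⇒≡false (λ found → let l , eq = Equivalence.to (∈ᵇ-tabulate⇔ (_↑ˡ k) (j ↑ʳ q)) found
                                      in ↑ˡ≢↑ʳ l q eq) = refl

module Compatibility (i j k : ℕ) where

  record Compatible (ε : Vec YN (i + j)) (η : Vec YN (j + k)) (ω : Vec YN (i + j + k)) : Set where
    field
      left  : ∀ p → lookup ε (p ↑ˡ j) ≡ lookup ω ((p ↑ˡ j) ↑ˡ k)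
      glued : ∀ l → mulYN (lookup ε (i ↑ʳ l)) (lookup η (l ↑ˡ k)) ≡ just (lookup ω ((i ↑ʳ l) ↑ˡ k))
      right : ∀ q → lookup η (j ↑ʳ q) ≡ lookup ω ((i + j) ↑ʳ q)

  module _ (ε : Vec YN (i + j)) (η : Vec YN (j + k)) (ω : Vec YN (i + j + k)) where

    private
      ωˡ : Vec YN (i + j)
      ωˡ = tabulate (lookup ω ∘ (_↑ˡ k))

      ωʳ ηʳ : Vec YN k
      ωʳ = tabulate (lookup ω ∘ ((i + j) ↑ʳ_))
      ηʳ = tabulate (lookup η ∘ (j ↑ʳ_))

      fold : Maybe (Vec YN (i + j))
      fold = foldMul (tabulate (i ↑ʳ_)) (tabulate (_↑ˡ k)) ε η

      ↑ʳ-injective : Injective _≡_ _≡_ (_↑ʳ_ {j} i)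
      ↑ʳ-injective = Fin.↑ʳ-injective i _ _

      ω-split : toList ω ≡ toList ωˡ ++ toList ωʳ
      ω-split = trans (cong toList (sym (tabulate-↑ˡ-++-tabulate-↑ʳ (i + j) ω))) (Vec.toList-++ ωˡ ωʳ)

      split⇔ : Maybe.map (λ e → toList e ++ toList ηʳ) fold ≡ just (toList ω) ⇔ (fold ≡ just ωˡ × ηʳ ≡ ωʳ)
      split⇔ = mk⇔ to from
        where
        to : Maybe.map (λ e → toList e ++ toList ηʳ) fold ≡ just (toList ω) → fold ≡ just ωˡ × ηʳ ≡ ωʳ
        to eq with fold | eq
        ... | just e | eq′ = let e≡ωˡ , ηʳ≡ωʳ = toList-++-injective e ωˡ ηʳ ωʳ (trans (MaybeP.just-injective eq′) ω-split) in
                             cong just e≡ωˡ , ηʳ≡ωʳ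
        from : fold ≡ just ωˡ × ηʳ ≡ ωʳ → Maybe.map (λ e → toList e ++ toList ηʳ) fold ≡ just (toList ω)
        from (fold≡ , ηʳ≡ωʳ) rewrite fold≡ | ηʳ≡ωʳ = cong just (sym ω-split)

      multiplied⇔ : (MultipliedAlong (i ↑ʳ_) (_↑ˡ k) ε η ωˡ × ηʳ ≡ ωʳ) ⇔ Compatible ε η ω
      multiplied⇔ = mk⇔
        (λ ((multiplied , untouched) , ηʳ≡ωʳ) → record
          { left  = λ p → trans (sym (untouched (p ↑ˡ j) (λ l → ↑ˡ≢↑ʳ p l ∘ sym))) (Vec.lookup∘tabulate _ (p ↑ˡ j))
          ; glued = λ l → trans (multiplied l) (cong just (Vec.lookup∘tabulate _ (i ↑ʳ l)))
          ; right = λ q → trans (sym (Vec.lookup∘tabulate _ q))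
                                (trans (cong (λ v → lookup v q) ηʳ≡ωʳ) (Vec.lookup∘tabulate _ q))
          })
        (λ c → let open Compatible c in
          ( (λ l → trans (glued l) (cong just (sym (Vec.lookup∘tabulate _ (i ↑ʳ l)))))
          , untouched left)
          , lookup-ext (λ q → trans (Vec.lookup∘tabulate _ q) (trans (right q) (sym (Vec.lookup∘tabulate _ q)))))
        where
        untouched : (∀ p → lookup ε (p ↑ˡ j) ≡ lookup ω ((p ↑ˡ j) ↑ˡ k)) →
                    ∀ p → (∀ l → i ↑ʳ l ≢ p) → lookup ωˡ p ≡ lookup ε p
        untouched left p p∉ with splitView i p
        ... | is↑ˡ a = trans (Vec.lookup∘tabulate _ (a ↑ˡ j)) (sym (left a))
        ... | is↑ʳ l = ⊥-elim (p∉ l refl)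

    combine⇔Compatible : combine (tabulate (i ↑ʳ_)) (tabulate (_↑ˡ k)) ε η ≡ just (toList ω) ⇔ Compatible ε η ω
    combine⇔Compatible rewrite combine≡ (tabulate (i ↑ʳ_)) (tabulate (_↑ˡ k)) ε η | unmatched-tabulate-↑ˡ j k η = begin
      (Maybe.map (λ e → toList e ++ toList ηʳ) fold ≡ just (toList ω))
        ≈⟨ split⇔ ⟩
      (fold ≡ just ωˡ × ηʳ ≡ ωʳ)
        ≈⟨ mk⇔ (Prod.map₁ (foldMul-tabulate⁻ η (i ↑ʳ_) (_↑ˡ k) ↑ʳ-injective ε ωˡ))
                 (Prod.map₁ (foldMul-tabulate⁺ η (i ↑ʳ_) (_↑ˡ k) ↑ʳ-injective ε ωˡ)) ⟩
      (MultipliedAlong (i ↑ʳ_) (_↑ˡ k) ε η ωˡ × ηʳ ≡ ωʳ)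
        ≈⟨ multiplied⇔ ⟩
      Compatible ε η ω ∎
      where open SetoidReasoning (⇔-setoid 0ℓ)

-- Gluing

module Gluing (i j k : ℕ) {V₁ V₂ : ℕ} (E₁ : Edges V₁) (E₂ : Edges V₂)
              (v : Fin (i + j) → Fin V₁) (w : Fin (j + k) → Fin V₂)
              (v-injective : Injective _≡_ _≡_ v) (w-injective : Injective _≡_ _≡_ w) where

  G₁ : Pointed (i + j)
  G₁ = pointed (graph V₁ E₁) v

  G₂ : Pointed (j + k)
  G₂ = pointed (graph V₂ E₂) w

  G : Pointed (i + j + k)
  G = glue i j k G₁ G₂

  -- v_{i+l} of G₁ and w_l of G₂ become one vertex of G
  seam₁ : Fin j → Fin V₁
  seam₁ l = v (i ↑ʳ l)

  seam₂ : Fin j → Fin V₂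
  seam₂ l = w (l ↑ˡ k)

  OffSeam₁ : Fin V₁ → Set
  OffSeam₁ a = ∀ l → seam₁ l ≢ a

  OffSeam₂ : Fin V₂ → Set
  OffSeam₂ b = ∀ l → seam₂ l ≢ b

  private
    identify : Fin V₂ → Maybe (Fin V₁)
    identify = glueLookup j seam₂ seam₁

  m : ℕ
  m = proj₁ (compress V₂ identify)

  h : Fin V₂ → Fin V₁ ⊎ Fin m
  h = proj₂ (compress V₂ identify)

  emb₁ : Fin V₁ → Fin (V₁ + m)
  emb₁ a = a ↑ˡ m

  emb₂ : Fin V₂ → Fin (V₁ + m)
  emb₂ b = [ emb₁ , V₁ ↑ʳ_ ] (h b)

  _⊕_ : Edges V₁ → Edges V₂ → Edges (V₁ + m)
  S₁ ⊕ S₂ = map (Prod.map emb₁ emb₁) S₁ ++ map (Prod.map emb₂ emb₂) S₂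

  private
    seam₁-injective : Injective _≡_ _≡_ seam₁
    seam₁-injective = Fin.↑ʳ-injective i _ _ ∘ v-injective

    seam₂-injective : Injective _≡_ _≡_ seam₂
    seam₂-injective = Fin.↑ˡ-injective k _ _ ∘ w-injective

    emb₁-injective : Injective _≡_ _≡_ emb₁
    emb₁-injective = Fin.↑ˡ-injective m _ _

    h-inj₁ : ∀ {b a} → h b ≡ inj₁ a → ∃[ l ] seam₂ l ≡ b × seam₁ l ≡ a
    h-inj₁ {b} hb = glueLookup-just j seam₂ seam₁ (trans (sym (compress-agrees V₂ identify b)) (cong [ just , const nothing ] hb))

    h-inj₂ : ∀ {b c} → h b ≡ inj₂ c → OffSeam₂ b
    h-inj₂ {b} hb l refl = case trans (sym (glueLookup-at j seam₂ seam₁ seam₂-injective l))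
                                      (trans (sym (compress-agrees V₂ identify b)) (cong [ just , const nothing ] hb)) of λ ()

  emb₂-seam : ∀ l → emb₂ (seam₂ l) ≡ emb₁ (seam₁ l)
  emb₂-seam l with h (seam₂ l) in hb
  ... | inj₁ a = let l′ , seam₂l′≡ , seam₁l′≡a = h-inj₁ hb in
                 cong emb₁ (trans (sym seam₁l′≡a) (cong seam₁ (seam₂-injective seam₂l′≡)))
  ... | inj₂ _ = ⊥-elim (h-inj₂ hb l refl)

  emb₂-off-seam : ∀ {b} → OffSeam₂ b → ∃[ c ] emb₂ b ≡ V₁ ↑ʳ c
  emb₂-off-seam {b} off with h b in hb
  ... | inj₁ _ = let l , seam₂l≡b , _ = h-inj₁ hb in ⊥-elim (off l seam₂l≡b)
  ... | inj₂ c = c , refl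

  emb₂≡emb₁ : ∀ {b a} → emb₂ b ≡ emb₁ a → ∃[ l ] seam₂ l ≡ b × seam₁ l ≡ a
  emb₂≡emb₁ {b} eq with h b in hb
  ... | inj₁ _ = let l , seam₂l≡b , seam₁l≡ = h-inj₁ hb in l , seam₂l≡b , trans seam₁l≡ (emb₁-injective eq)
  ... | inj₂ c = ⊥-elim (↑ˡ≢↑ʳ _ c (sym eq))

  emb₂-onto : ∀ c → ∃[ b ] emb₂ b ≡ V₁ ↑ʳ c × OffSeam₂ b
  emb₂-onto c = let b , hb = compress-surjective V₂ identify c in b , cong [ emb₁ , V₁ ↑ʳ_ ] hb , h-inj₂ hb

  emb₂-injective : Injective _≡_ _≡_ emb₂
  emb₂-injective {x} {y} eq with h x in hx | h y in hy
  ... | inj₂ c | inj₂ _ =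
    compress-injective V₂ identify hx (trans hx (trans (cong inj₂ (Fin.↑ʳ-injective V₁ _ _ eq)) (sym hy)))
  ... | inj₁ a | inj₂ c = ⊥-elim (↑ˡ≢↑ʳ a c eq)
  ... | inj₂ c | inj₁ a = ⊥-elim (↑ˡ≢↑ʳ a c (sym eq))
  ... | inj₁ a | inj₁ _ =
    let l  , seam₂l≡x  , seam₁l≡a  = h-inj₁ hx
        l′ , seam₂l′≡y , seam₁l′≡a′ = h-inj₁ hy
    in trans (sym seam₂l≡x)
         (trans (cong seam₂ (seam₁-injective (trans seam₁l≡a (trans (emb₁-injective eq) (sym seam₁l′≡a′)))))
                seam₂l′≡y)

  deg-⊕-emb₁ : ∀ S₁ S₂ {a} → OffSeam₁ a → deg (S₁ ⊕ S₂) (emb₁ a) ≡ deg S₁ a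
  deg-⊕-emb₁ S₁ S₂ {a} off = begin
    deg (S₁ ⊕ S₂) (emb₁ a)
      ≡⟨ deg-++ (map (Prod.map emb₁ emb₁) S₁) _ (emb₁ a) ⟩
    deg (map (Prod.map emb₁ emb₁) S₁) (emb₁ a) + deg (map (Prod.map emb₂ emb₂) S₂) (emb₁ a)
      ≡⟨ cong₂ _+_ (deg-map-injective emb₁ emb₁-injective S₁ a) (deg-map-∉ emb₂ (emb₁ a) emb₂≢ S₂) ⟩
    deg S₁ a + 0
      ≡⟨ ℕ.+-identityʳ _ ⟩
    deg S₁ a ∎
    where
    open ≡-Reasoning
    emb₂≢ : ∀ b → emb₂ b ≢ emb₁ a
    emb₂≢ b eq = let l , _ , seam₁l≡a = emb₂≡emb₁ eq in off l seam₁l≡a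

  deg-⊕-seam : ∀ S₁ S₂ l → deg (S₁ ⊕ S₂) (emb₁ (seam₁ l)) ≡ deg S₁ (seam₁ l) + deg S₂ (seam₂ l)
  deg-⊕-seam S₁ S₂ l = trans (deg-++ (map (Prod.map emb₁ emb₁) S₁) _ _)
    (cong₂ _+_ (deg-map-injective emb₁ emb₁-injective S₁ (seam₁ l))
               (trans (cong (deg (map (Prod.map emb₂ emb₂) S₂)) (sym (emb₂-seam l)))
                      (deg-map-injective emb₂ emb₂-injective S₂ (seam₂ l))))

  deg-⊕-emb₂ : ∀ S₁ S₂ {b} → OffSeam₂ b → deg (S₁ ⊕ S₂) (emb₂ b) ≡ deg S₂ b
  deg-⊕-emb₂ S₁ S₂ {b} off = let c , emb₂b≡ = emb₂-off-seam off in
    trans (deg-++ (map (Prod.map emb₁ emb₁) S₁) _ _)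
      (cong₂ _+_ (trans (cong (deg (map (Prod.map emb₁ emb₁) S₁)) emb₂b≡)
                        (deg-map-∉ emb₁ (V₁ ↑ʳ c) (λ a → ↑ˡ≢↑ʳ a c) S₁))
                 (deg-map-injective emb₂ emb₂-injective S₂ b))

  pts-↑ˡ : ∀ p → pts G (p ↑ˡ k) ≡ emb₁ (v p)
  pts-↑ˡ p rewrite Fin.splitAt-↑ˡ (i + j) p k = refl

  pts-↑ʳ : ∀ q → pts G ((i + j) ↑ʳ q) ≡ emb₂ (w (j ↑ʳ q))
  pts-↑ʳ q rewrite Fin.splitAt-↑ʳ (i + j) k q = refl

  off-seam₁ : ∀ p → OffSeam₁ (v (p ↑ˡ j))
  off-seam₁ p l eq = ↑ˡ≢↑ʳ p l (sym (v-injective eq))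

  off-seam₂ : ∀ q → OffSeam₂ (w (j ↑ʳ q))
  off-seam₂ q l eq = ↑ˡ≢↑ʳ l q (w-injective eq)

  pts-injective : Injective _≡_ _≡_ (pts G)
  pts-injective {x} {y} eq with splitView (i + j) x | splitView (i + j) y
  ... | is↑ˡ p | is↑ˡ p′ = cong (_↑ˡ k) (v-injective (emb₁-injective (trans (sym (pts-↑ˡ p)) (trans eq (pts-↑ˡ p′)))))
  ... | is↑ʳ q | is↑ʳ q′ =
    cong ((i + j) ↑ʳ_) (Fin.↑ʳ-injective j _ _ (w-injective (emb₂-injective (trans (sym (pts-↑ʳ q)) (trans eq (pts-↑ʳ q′))))))
  ... | is↑ˡ p | is↑ʳ q  =
    let l , seam₂l≡ , _ = emb₂≡emb₁ (trans (sym (pts-↑ʳ q)) (trans (sym eq) (pts-↑ˡ p))) in ⊥-elim (off-seam₂ q l seam₂l≡)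
  ... | is↑ʳ q | is↑ˡ p  =
    let l , seam₂l≡ , _ = emb₂≡emb₁ (trans (sym (pts-↑ʳ q)) (trans eq (pts-↑ˡ p))) in ⊥-elim (off-seam₂ q l seam₂l≡)


  unpointed-emb₁ : ∀ {a} → Unpointed G₁ a → Unpointed G (emb₁ a)
  unpointed-emb₁ a∉ x eq with splitView (i + j) x
  ... | is↑ˡ p = a∉ p (emb₁-injective (trans (sym (pts-↑ˡ p)) eq))
  ... | is↑ʳ q = let l , seam₂l≡ , _ = emb₂≡emb₁ (trans (sym (pts-↑ʳ q)) eq) in off-seam₂ q l seam₂l≡

  unpointed-emb₂ : ∀ {b} → Unpointed G₂ b → Unpointed G (emb₂ b)
  unpointed-emb₂ b∉ x eq with splitView (i + j) x
  ... | is↑ˡ p = let l , seam₂l≡b , _ = emb₂≡emb₁ (trans (sym eq) (pts-↑ˡ p)) in b∉ (l ↑ˡ k) seam₂l≡b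
  ... | is↑ʳ q = b∉ (j ↑ʳ q) (emb₂-injective (trans (sym (pts-↑ʳ q)) eq))

  unpointed-emb₁⁻ : ∀ {a} → Unpointed G (emb₁ a) → Unpointed G₁ a
  unpointed-emb₁⁻ a∉ p vp≡a = a∉ (p ↑ˡ k) (trans (pts-↑ˡ p) (cong emb₁ vp≡a))

  unpointed-emb₂⁻ : ∀ {b} → Unpointed G (emb₂ b) → OffSeam₂ b → Unpointed G₂ b
  unpointed-emb₂⁻ b∉ off q wq≡b with splitView j q
  ... | is↑ˡ l  = off l wq≡b
  ... | is↑ʳ q′ = b∉ ((i + j) ↑ʳ q′) (trans (pts-↑ʳ q′) (cong emb₂ wq≡b))

  module _ (S₁ : Edges V₁) (S₂ : Edges V₂) where

    deg-pts-left : ∀ p → deg (S₁ ⊕ S₂) (pts G ((p ↑ˡ j) ↑ˡ k)) ≡ deg S₁ (v (p ↑ˡ j))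
    deg-pts-left p = trans (cong (deg (S₁ ⊕ S₂)) (pts-↑ˡ (p ↑ˡ j))) (deg-⊕-emb₁ S₁ S₂ (off-seam₁ p))

    deg-pts-seam : ∀ l → deg (S₁ ⊕ S₂) (pts G ((i ↑ʳ l) ↑ˡ k)) ≡ deg S₁ (seam₁ l) + deg S₂ (seam₂ l)
    deg-pts-seam l = trans (cong (deg (S₁ ⊕ S₂)) (pts-↑ˡ (i ↑ʳ l))) (deg-⊕-seam S₁ S₂ l)

    deg-pts-right : ∀ q → deg (S₁ ⊕ S₂) (pts G ((i + j) ↑ʳ q)) ≡ deg S₂ (w (j ↑ʳ q))
    deg-pts-right q = trans (cong (deg (S₁ ⊕ S₂)) (pts-↑ʳ q)) (deg-⊕-emb₂ S₁ S₂ (off-seam₂ q))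

    private
      state₁ : ∀ p → lookup (stateOf G₁ S₁) p ≡ label (deg S₁ (v p))
      state₁ = Vec.lookup∘tabulate _

      state₂ : ∀ q → lookup (stateOf G₂ S₂) q ≡ label (deg S₂ (w q))
      state₂ = Vec.lookup∘tabulate _

    open Compatibility i j k

    realises-⊕⁻ : ∀ ω → T (realises G ω (S₁ ⊕ S₂)) →
      T (admissible G₁ S₁) × T (admissible G₂ S₂) × Compatible (stateOf G₁ S₁) (stateOf G₂ S₂) ω
    realises-⊕⁻ ω re =
        Equivalence.from (PointedInjective.admissible⇔ G₁ v-injective S₁) (at₁ , off₁)
      , Equivalence.from (PointedInjective.admissible⇔ G₂ w-injective S₂) (at₂ , off₂)
      , record
        { left  = λ p → trans (state₁ _) (proj₂ (left p))
        ; glued = λ l → trans (cong₂ mulYN (state₁ _) (state₂ _)) (proj₂ (proj₂ (seam l)))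
        ; right = λ q → trans (state₂ _) (proj₂ (right q))
        }
      where
      at : ∀ x → deg (S₁ ⊕ S₂) (pts G x) ≡ demand (isY (lookup ω x))
      at = proj₁ (Equivalence.to (PointedInjective.realises⇔ G pts-injective ω (S₁ ⊕ S₂)) re)
      off : ∀ x → Unpointed G x → deg (S₁ ⊕ S₂) x ≡ 1
      off = proj₂ (Equivalence.to (PointedInjective.realises⇔ G pts-injective ω (S₁ ⊕ S₂)) re)
      left : ∀ p → deg S₁ (v (p ↑ˡ j)) ≤ 1 × label (deg S₁ (v (p ↑ˡ j))) ≡ lookup ω ((p ↑ˡ j) ↑ˡ k)
      left p = Equivalence.to (≡demand⇔ _ _) (trans (sym (deg-pts-left p)) (at _))
      seam : ∀ l → deg S₁ (seam₁ l) ≤ 1 × deg S₂ (seam₂ l) ≤ 1 ×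
                   mulYN (label (deg S₁ (seam₁ l))) (label (deg S₂ (seam₂ l))) ≡ just (lookup ω ((i ↑ʳ l) ↑ˡ k))
      seam l = Equivalence.to (+≡demand⇔ _ _ _) (trans (sym (deg-pts-seam l)) (at _))
      right : ∀ q → deg S₂ (w (j ↑ʳ q)) ≤ 1 × label (deg S₂ (w (j ↑ʳ q))) ≡ lookup ω ((i + j) ↑ʳ q)
      right q = Equivalence.to (≡demand⇔ _ _) (trans (sym (deg-pts-right q)) (at _))
      at₁ : ∀ p → deg S₁ (v p) ≤ 1
      at₁ p with splitView i p
      ... | is↑ˡ p₀ = proj₁ (left p₀)
      ... | is↑ʳ l  = proj₁ (seam l)
      at₂ : ∀ q → deg S₂ (w q) ≤ 1
      at₂ q with splitView j q
      ... | is↑ˡ l  = proj₁ (proj₂ (seam l))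
      ... | is↑ʳ q′ = proj₁ (right q′)
      off₁ : ∀ a → Unpointed G₁ a → deg S₁ a ≡ 1
      off₁ a a∉ = trans (sym (deg-⊕-emb₁ S₁ S₂ (a∉ ∘ (i ↑ʳ_)))) (off (emb₁ a) (unpointed-emb₁ a∉))
      off₂ : ∀ b → Unpointed G₂ b → deg S₂ b ≡ 1
      off₂ b b∉ = trans (sym (deg-⊕-emb₂ S₁ S₂ (b∉ ∘ (_↑ˡ k)))) (off (emb₂ b) (unpointed-emb₂ b∉))

    realises-⊕⁺ : ∀ ω → T (admissible G₁ S₁) → T (admissible G₂ S₂) →
      Compatible (stateOf G₁ S₁) (stateOf G₂ S₂) ω →
      T (realises G ω (S₁ ⊕ S₂))
    realises-⊕⁺ ω adm₁ adm₂ c = Equivalence.from (PointedInjective.realises⇔ G pts-injective ω (S₁ ⊕ S₂)) (at , off)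
      where
      open Compatible c
      at₁ : ∀ p → deg S₁ (v p) ≤ 1
      at₁ = proj₁ (Equivalence.to (PointedInjective.admissible⇔ G₁ v-injective S₁) adm₁)
      off₁ : ∀ a → Unpointed G₁ a → deg S₁ a ≡ 1
      off₁ = proj₂ (Equivalence.to (PointedInjective.admissible⇔ G₁ v-injective S₁) adm₁)
      at₂ : ∀ q → deg S₂ (w q) ≤ 1
      at₂ = proj₁ (Equivalence.to (PointedInjective.admissible⇔ G₂ w-injective S₂) adm₂)
      off₂ : ∀ b → Unpointed G₂ b → deg S₂ b ≡ 1
      off₂ = proj₂ (Equivalence.to (PointedInjective.admissible⇔ G₂ w-injective S₂) adm₂)
      at : ∀ x → deg (S₁ ⊕ S₂) (pts G x) ≡ demand (isY (lookup ω x))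
      at x with splitView (i + j) x
      at x | is↑ʳ q = trans (deg-pts-right q) (Equivalence.from (≡demand⇔ _ _) (at₂ _ , trans (sym (state₂ _)) (right q)))
      at x | is↑ˡ p with splitView i p
      ... | is↑ˡ p₀ = trans (deg-pts-left p₀) (Equivalence.from (≡demand⇔ _ _) (at₁ _ , trans (sym (state₁ _)) (left p₀)))
      ... | is↑ʳ l  = trans (deg-pts-seam l)
                        (Equivalence.from (+≡demand⇔ _ _ _)
                          (at₁ _ , at₂ _ , trans (sym (cong₂ mulYN (state₁ _) (state₂ _))) (glued l)))
      off : ∀ x → Unpointed G x → deg (S₁ ⊕ S₂) x ≡ 1
      off x x∉ with splitView V₁ x
      ... | is↑ˡ a = let a∉ = unpointed-emb₁⁻ x∉ in
                     trans (deg-⊕-emb₁ S₁ S₂ (a∉ ∘ (i ↑ʳ_))) (off₁ a a∉)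
      ... | is↑ʳ c = let b , emb₂b≡ , off-seam = emb₂-onto c
                         b∉ = unpointed-emb₂⁻ (subst (Unpointed G) (sym emb₂b≡) x∉) off-seam in
                     trans (cong (deg (S₁ ⊕ S₂)) (sym emb₂b≡)) (trans (deg-⊕-emb₂ S₁ S₂ off-seam) (off₂ b b∉))

  compatible? : Vec YN (i + j + k) → Vec YN (i + j) → Vec YN (j + k) → Bool
  compatible? ω ε η =
    does (MaybeP.≡-dec (List.≡-dec _≟YN_) (combine (tabulate (i ↑ʳ_)) (tabulate (_↑ˡ k)) ε η) (just (toList ω)))

  realises-⊕≡ : ∀ ω S₁ S₂ → 𝟙 (realises G ω (S₁ ⊕ S₂))
    ≡ 𝟙 (admissible G₁ S₁) * (𝟙 (admissible G₂ S₂) * 𝟙 (compatible? ω (stateOf G₁ S₁) (stateOf G₂ S₂)))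
  realises-⊕≡ ω S₁ S₂ = sym (begin
    𝟙 (admissible G₁ S₁) * (𝟙 (admissible G₂ S₂) * 𝟙 (compatible? ω ε η))
      ≡⟨ cong (𝟙 (admissible G₁ S₁) *_) (𝟙-∧ (admissible G₂ S₂) _) ⟩
    𝟙 (admissible G₁ S₁) * 𝟙 (admissible G₂ S₂ ∧ compatible? ω ε η)
      ≡⟨ 𝟙-∧ (admissible G₁ S₁) _ ⟩
    𝟙 (admissible G₁ S₁ ∧ admissible G₂ S₂ ∧ compatible? ω ε η)
      ≡⟨ cong 𝟙 (T-injective to from) ⟩
    𝟙 (realises G ω (S₁ ⊕ S₂)) ∎)
    where
    open ≡-Reasoning
    open Compatibility i j k
    ε : Vec YN (i + j)
    ε = stateOf G₁ S₁
    η : Vec YN (j + k)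
    η = stateOf G₂ S₂
    combine? : Dec (combine (tabulate (i ↑ʳ_)) (tabulate (_↑ˡ k)) ε η ≡ just (toList ω))
    combine? = MaybeP.≡-dec (List.≡-dec _≟YN_) (combine (tabulate (i ↑ʳ_)) (tabulate (_↑ˡ k)) ε η) (just (toList ω))
    to : T (admissible G₁ S₁ ∧ admissible G₂ S₂ ∧ compatible? ω ε η) → T (realises G ω (S₁ ⊕ S₂))
    to all₃ = let adm₁ , rest = Equivalence.to T-∧ all₃
                  adm₂ , c    = Equivalence.to T-∧ rest in
      realises-⊕⁺ S₁ S₂ ω adm₁ adm₂ (Equivalence.to (combine⇔Compatible ε η ω) (T-does⁻ combine? c))
    from : T (realises G ω (S₁ ⊕ S₂)) → T (admissible G₁ S₁ ∧ admissible G₂ S₂ ∧ compatible? ω ε η)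
    from re = let adm₁ , adm₂ , c = realises-⊕⁻ S₁ S₂ ω re in
      Equivalence.from T-∧
        (adm₁ , Equivalence.from T-∧ (adm₂ , T-does⁺ combine? (Equivalence.from (combine⇔Compatible ε η ω) c)))

  realisations-glue : ∀ ω →
    realisations G ω ≡ ∑[ S₁ ∈ subsets E₁ ] ∑[ S₂ ∈ subsets E₂ ] 𝟙 (realises G ω (S₁ ⊕ S₂))
  realisations-glue ω =
    trans (∑-subsets-++ (map (Prod.map emb₁ emb₁) E₁) _ _)
      (trans (∑-subsets-map _ E₁ _) (∑-cong (subsets E₁) (λ S₁ → ∑-subsets-map _ E₂ _)))

  ∑-realisations-pairs : ∀ (c : Vec YN (i + j) → Vec YN (j + k) → Bool) →
    ∑[ ε ∈ allWords (i + j) ] ∑[ η ∈ allWords (j + k) ] realisations G₁ ε * (realisations G₂ η * 𝟙 (c ε η))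
      ≡ ∑[ S₁ ∈ subsets E₁ ] ∑[ S₂ ∈ subsets E₂ ]
          𝟙 (admissible G₁ S₁) * (𝟙 (admissible G₂ S₂) * 𝟙 (c (stateOf G₁ S₁) (stateOf G₂ S₂)))
  ∑-realisations-pairs c = begin
    ∑[ ε ∈ allWords (i + j) ] ∑[ η ∈ allWords (j + k) ] realisations G₁ ε * (realisations G₂ η * 𝟙 (c ε η))
      ≡⟨ ∑-cong (allWords (i + j)) (λ ε → ∑-*ˡ (realisations G₁ ε) (allWords (j + k)) _) ⟨
    ∑[ ε ∈ allWords (i + j) ] realisations G₁ ε * (∑[ η ∈ allWords (j + k) ] realisations G₂ η * 𝟙 (c ε η))
      ≡⟨ PointedInjective.∑-realisations G₁ v-injective _ ⟩
    ∑[ S₁ ∈ subsets E₁ ] 𝟙 (admissible G₁ S₁) *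
      (∑[ η ∈ allWords (j + k) ] realisations G₂ η * 𝟙 (c (stateOf G₁ S₁) η))
      ≡⟨ ∑-cong (subsets E₁) (λ S₁ → cong (𝟙 (admissible G₁ S₁) *_)
                                        (PointedInjective.∑-realisations G₂ w-injective (𝟙 ∘ c (stateOf G₁ S₁)))) ⟩
    ∑[ S₁ ∈ subsets E₁ ] 𝟙 (admissible G₁ S₁) *
      (∑[ S₂ ∈ subsets E₂ ] 𝟙 (admissible G₂ S₂) * 𝟙 (c (stateOf G₁ S₁) (stateOf G₂ S₂)))
      ≡⟨ ∑-cong (subsets E₁) (λ S₁ → ∑-*ˡ (𝟙 (admissible G₁ S₁)) (subsets E₂) _) ⟩
    ∑[ S₁ ∈ subsets E₁ ] ∑[ S₂ ∈ subsets E₂ ]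
      𝟙 (admissible G₁ S₁) * (𝟙 (admissible G₂ S₂) * 𝟙 (c (stateOf G₁ S₁) (stateOf G₂ S₂))) ∎
    where open ≡-Reasoning

  φ≡∑realisations : ∀ ω → φ (tabulate (i ↑ʳ_)) (tabulate (_↑ˡ k)) (stateSum G₁) (stateSum G₂) (toList ω)
    ≡ ℤ.+ (∑[ ε ∈ allWords (i + j) ] ∑[ η ∈ allWords (j + k) ]
             realisations G₁ ε * (realisations G₂ η * 𝟙 (compatible? ω ε η)))
  φ≡∑realisations ω =
    trans (cong sumℤ (List.concatMap-cong (λ ε → List.map-cong (term≡ ε) (allWords (j + k))) (allWords (i + j))))
          (sumℤ-concatMap-map-pos (allWords (i + j)) (allWords (j + k)) _)
    where
    term≡ : ∀ ε η → (if compatible? ω ε η then stateSum G₁ ε ℤ.* stateSum G₂ η else ℤ.+ 0)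
                    ≡ ℤ.+ (realisations G₁ ε * (realisations G₂ η * 𝟙 (compatible? ω ε η)))
    term≡ ε η =
      trans (cong (λ z → if compatible? ω ε η then z else ℤ.+ 0)
                  (cong₂ ℤ._*_ (stateSum≡realisations G₁ ε) (stateSum≡realisations G₂ η)))
            (if-pos-* (compatible? ω ε η) (realisations G₁ ε) (realisations G₂ η))

lemma2p4 : (i j k : ℕ) (G₁ : Pointed (i + j)) (G₂ : Pointed (j + k)) →
    Injective _≡_ _≡_ (pts G₁) → Injective _≡_ _≡_ (pts G₂) →
    (ω : Vec YN (i + j + k)) →
    stateSum (glue i j k G₁ G₂) ω
      ≡ φ (tabulate (i ↑ʳ_)) (tabulate (_↑ˡ k)) (stateSum G₁) (stateSum G₂) (toList ω)
lemma2p4 i j k (pointed (graph V₁ E₁) v) (pointed (graph V₂ E₂) w) v-injective w-injective ω = begin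
  stateSum G ω
    ≡⟨ stateSum≡realisations G ω ⟩
  ℤ.+ realisations G ω
    ≡⟨ cong ℤ.+_ (realisations-glue ω) ⟩
  ℤ.+ (∑[ S₁ ∈ subsets E₁ ] ∑[ S₂ ∈ subsets E₂ ] 𝟙 (realises G ω (S₁ ⊕ S₂)))
    ≡⟨ cong ℤ.+_ (∑-cong (subsets E₁) (λ S₁ → ∑-cong (subsets E₂) (realises-⊕≡ ω S₁))) ⟩
  ℤ.+ (∑[ S₁ ∈ subsets E₁ ] ∑[ S₂ ∈ subsets E₂ ]
         𝟙 (admissible G₁ S₁) * (𝟙 (admissible G₂ S₂) * 𝟙 (compatible? ω (stateOf G₁ S₁) (stateOf G₂ S₂))))
    ≡⟨ cong ℤ.+_ (∑-realisations-pairs (compatible? ω)) ⟨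
  ℤ.+ (∑[ ε ∈ allWords (i + j) ] ∑[ η ∈ allWords (j + k) ]
         realisations G₁ ε * (realisations G₂ η * 𝟙 (compatible? ω ε η)))
    ≡⟨ φ≡∑realisations ω ⟨
  φ (tabulate (i ↑ʳ_)) (tabulate (_↑ˡ k)) (stateSum G₁) (stateSum G₂) (toList ω) ∎
  where
  open ≡-Reasoning
  open Gluing i j k E₁ E₂ v w v-injective w-injective
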